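{- Let $a_1,\ldots,a_k\in[n]$ with induced blocks $\mathscr{B}_1,\ldots,\mathscr{B}_t$, where $\mathscr{B}_t$ is the block containing $n$. If $n\in\{a_1,\ldots,a_k\}$, then \[\mathbb{E}_{\mathfrak{S}_{n,r}}[X_{a_1}\cdots X_{a_k}]=\left(\frac{r-1}{r}\right)^{|\mathscr{B}_t|}\cdot\prod_{i=1}^t\frac{1}{|\mathscr{B}_i|!}.\]
   Context: $\mathfrak{S}_{n,r}$ is the set of pairs $(\omega,\tau)$, $\omega\in\mathfrak{S}_n$, $\tau:[n]\to\mathbb{Z}_r$ (colors $0,\ldots,r-1$). Order symbols $i^c$ by $1^0<\cdots<n^0<1^1<\cdots<n^1<\cdots<1^{r-1}<\cdots<n^{r-1}$. An index $i\in[n]$ is a descent of $(\omega,\tau)$ if $\omega(i)^{\tau(i)}>\omega(i+1)^{\tau(i+1)}$, with the convention $\omega(n+1)=n+1$, $\tau(n+1)=0$. $X_i$ is the indicator that $i$ is a descent; the $a_i$ need not be distinct. The Young subgroup generated by $a_1,\ldots,a_k$ is the subgroup $J\le\mathfrak{S}_n$ generated by the transpositions $(a_i,a_i+1)$ with $a_i\neq n$; the blocks induced by $a_1,\ldots,a_k$ are the orbits of $J$ on $[n]$. Expectation is with respect to the uniform distribution on $\mathfrak{S}_{n,r}$. -}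

module Defs where

open import Data.Nat as ℕ using (ℕ; zero; suc; _+_; _*_; _∸_; _<_; NonZero)
open import Data.Nat using (_!)
open import Data.Nat.ListAction using (sum)
open import Data.Fin as Fin using (Fin; toℕ)
open import Data.Fin.Subset using (Subset; _∈_; ∣_∣)
open import Data.Integer using (+_)
open import Data.Rational as ℚ using (ℚ; _/_; 1ℚ; 0ℚ)
open import Data.Vec as Vec using (Vec; []; _∷_; lookup; toList)
open import Data.List as List using (List; []; _∷_; allFin; concatMap; filter; cartesianProduct; foldr; length; map)
import Data.List.Membership.Propositional as LM
open import Data.List.Relation.Unary.All using (All)
open import Data.List.Relation.Unary.Unique.Propositional using (Unique)
import Data.List.Relation.Unary.Unique.DecPropositional as UDec
open import Data.Fin.Properties using (_≟_)
open import Data.Product using (_×_; _,_; Σ; proj₁; proj₂; ∃)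
open import Relation.Binary.PropositionalEquality using (_≡_)
open import Relation.Binary.Construct.Closure.Equivalence using (EqClosure)
open import Relation.Nullary using (Dec; does)
open import Relation.Nullary.Decidable using (_⊎-dec_; _×-dec_)
open import Data.Bool using (if_then_else_)
open import Function.Bundles using (_⇔_)
import Data.Nat.Properties

-- Conventions: [n] is represented by Fin n (the element i : Fin n stands
-- for the integer toℕ i + 1).  Colors Z_r are Fin r.

IsTop : {n : ℕ} → Fin n → Set
IsTop {n} i = suc (toℕ i) ≡ n

allVecs : (n m : ℕ) → List (Vec (Fin m) n)
allVecs zero    m = [] ∷ []
allVecs (suc n) m = concatMap (λ v → map (λ x → x ∷ v) (allFin m)) (allVecs n m)

-- The symmetric group S_n, as the list of all words ω(1)…ω(n) with
-- pairwise distinct letters (i.e. all bijections [n] → [n]), each once.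
Perms : (n : ℕ) → List (Vec (Fin n) n)
Perms n = filter (λ v → UDec.unique? _≟_ (toList v)) (allVecs n n)

ColPerm : (n r : ℕ) → Set
ColPerm n r = Vec (Fin n) n × Vec (Fin r) n

S : (n r : ℕ) → List (ColPerm n r)
S n r = cartesianProduct (Perms n) (allVecs n r)

-- The symbol ω(i)^τ(i) encoded as (value in {1..n+1}, color)
-- Strict order on symbols: v^c < w^d  iff  c < d, or c = d and v < w.
_≺_ : ℕ × ℕ → ℕ × ℕ → Set
(v , c) ≺ (w , d) = (c < d) Data.Sum.⊎ ((c ≡ d) × (v < w))
  where import Data.Sum

-- symbol at position p+1 (p : ℕ, 0-based); position n+1 is (n+1)^0
symbolAt : {n r : ℕ} → ColPerm n r → ℕ → ℕ × ℕ
symbolAt {n} {r} (ω , τ) p = go p (toList ω) (toList τ)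
  where
  go : ℕ → List (Fin n) → List (Fin r) → ℕ × ℕ
  go zero    (x ∷ _)  (c ∷ _)  = suc (toℕ x) , toℕ c
  go (suc p) (_ ∷ xs) (_ ∷ cs) = go p xs cs
  go _       _        _        = suc n , 0

IsDescent : {n r : ℕ} → ColPerm n r → Fin n → Set
IsDescent σ i = symbolAt σ (suc (toℕ i)) ≺ symbolAt σ (toℕ i)

_≺?_ : (x y : ℕ × ℕ) → Dec (x ≺ y)
(v , c) ≺? (w , d) = (c ℕ.<? d) ⊎-dec ((c ℕ.≟ d) ×-dec (v ℕ.<? w))

X : {n r : ℕ} → Fin n → ColPerm n r → ℕ
X σi σ = if does (symbolAt σ (suc (toℕ σi)) ≺? symbolAt σ (toℕ σi)) then 1 else 0

prodX : {n r : ℕ} → List (Fin n) → ColPerm n r → ℕ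
prodX as σ = foldr (λ a acc → X a σ * acc) 1 as

-- Expectation w.r.t. the uniform distribution on a finite list
-- (average of the values; 0 for the empty list, which does not occur for r ≥ 1)
avg : {A : Set} → List A → (A → ℕ) → ℚ
avg xs f with length xs
... | zero  = 0ℚ
... | suc m = (+ sum (map f xs)) / suc m

E : (n r : ℕ) → (ColPerm n r → ℕ) → ℚ
E n r f = avg (S n r) f

_^ℚ_ : ℚ → ℕ → ℚ
q ^ℚ zero  = 1ℚ
q ^ℚ suc k = q ℚ.* (q ^ℚ k)

-- Blocks induced by a_1,…,a_k: orbits of the Young subgroup J generated by
-- the transpositions (a_i, a_i+1), a_i ≠ n.  Two elements lie in the same
-- orbit of the group generated by a set of transpositions iff they are
-- related by the equivalence closure of "swapped by a generator".
SwappedBy : {n : ℕ} → List (Fin n) → Fin n → Fin n → Set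
SwappedBy as i j = (i LM.∈ as) × (toℕ j ≡ suc (toℕ i))

SameOrbit : {n : ℕ} → List (Fin n) → Fin n → Fin n → Set
SameOrbit as = EqClosure (SwappedBy as)

IsBlock : {n : ℕ} → List (Fin n) → Subset n → Set
IsBlock {n} as B =
  (∃ λ i → i ∈ B) ×
  ((i j : Fin n) → i ∈ B → (j ∈ B ⇔ SameOrbit as i j))

IsBlockList : {n : ℕ} → List (Fin n) → List (Subset n) → Set
IsBlockList {n} as Bs =
  All (IsBlock as) Bs × Unique Bs × ((i : Fin n) → ∃ λ B → (B LM.∈ Bs) × (i ∈ B))

invFactProd : {n : ℕ} → List (Subset n) → ℚ
invFactProd [] = 1ℚ
invFactProd (B ∷ Bs) = (_/_ (+ 1) (∣ B ∣ !) {{Data.Nat.Properties._!≢0 (∣ B ∣)}}) ℚ.* invFactProd Bs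

{-# OPTIONS --safe #-}
module Submission where

-- The blocks are intervals of positions, and inside a block every position but
-- the last is one of the a_i. Because n is one of them, the last block ends at n and the
-- descent at n says τ(n) ≠ 0; colours cannot increase from left to right along a descent, so
-- "X_a = 1 for every a_i" means: all colours on the last block are nonzero, and every block is
-- decreasing. The colour condition has probability ((r-1)/r)^|B_t| and is unchanged by
-- permuting the entries of any block. For such a condition, moving the last entry of a block
-- of length k+1 to each of its k+1 possible places, of which exactly one keeps the block
-- decreasing when the first k entries were, shows that each block contributes 1/|B_i|!.

open import Defs

module _ where

  open import Data.Bool using (Bool; true; false; if_then_else_; _∧_; not; T)
  open import Data.Bool.ListAction using (all)
  open import Data.Bool.Properties using (∧-identityʳ; ∧-assoc; ∧-comm; T-∧; T-≡; ⇔→≡)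
  open import Data.Empty using (⊥-elim)
  open import Data.Fin as Fin using (Fin; toℕ; fromℕ<)
  open import Data.Fin.Properties using (toℕ-injective; toℕ-fromℕ<; fromℕ<-toℕ; fromℕ<-cong; toℕ<n) renaming (_≟_ to _≟ᶠ_)
  open import Data.Fin.Subset using (Subset; _∈_; ∣_∣; inside; outside)
  open import Data.Fin.Subset.Properties using (_∈?_; ⊆-antisym)
  open import Data.List as List using (List; []; _∷_; _++_; map; concatMap; filter; cartesianProduct; length; upTo; take; drop; zipWith; allFin; tabulate)
  open import Data.List.Properties using (map-++; map-∘; map-cong; map-cong-local; map-upTo; length-upTo; length-take; length-drop; length-tabulate; map-tabulate)
  open import Data.List.Membership.Propositional using () renaming (_∈_ to _∈ₗ_)
  open import Data.List.Membership.Propositional.Properties using (∈-filter⁻; ∈-filter⁺; ∈-cartesianProduct⁻; ∈-upTo⁻; ∈-++⁺ʳ; ∈-map⁺; ∈-map⁻; ∈-concat⁺′; ∈-allFin)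
  open import Data.List.Relation.Unary.All as All using (All; []; _∷_)
  import Data.List.Relation.Unary.All.Properties as All
  open import Data.List.Relation.Unary.All.Properties using (all⁺; all⁻)
  open import Data.List.Relation.Unary.AllPairs using (AllPairs; []; _∷_)
  open import Data.List.Relation.Unary.Any using (here; there)
  open import Data.List.Relation.Unary.Unique.DecPropositional using (unique?)
  open import Data.List.Relation.Unary.Unique.Propositional using (Unique)
  import Data.List.Relation.Unary.Unique.Propositional.Properties as Unique
  open import Data.Nat using (ℕ; zero; suc; _+_; _*_; _^_; _∸_; _<_; _≤_; _⊔_; _!; _<ᵇ_; _<?_; _≤?_; s≤s; z≤n; s≤s⁻¹; NonZero)
  open import Data.Nat.ListAction using (sum; product)
  open import Data.Nat.ListAction.Properties using (sum-++; product≢0)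
  open import Data.Nat.Properties
  open import Algebra.Properties.CommutativeSemigroup +-commutativeSemigroup using () renaming (interchange to +-interchange)
  open import Data.Nat.Solver using (module +-*-Solver)
  open import Data.Product as Product using (_×_; _,_; proj₁; proj₂; swap; ∃; ∃₂; Σ)
  open import Data.Product.Relation.Binary.Lex.Strict using (×-strictTotalOrder)
  open import Data.Product.Relation.Binary.Pointwise.NonDependent using (≡×≡⇒≡)
  open import Data.Sum using (_⊎_; inj₁; inj₂; [_,_])
  open import Data.Vec as Vec using (Vec; []; _∷_; toList; here; there)
  open import Data.Vec.Properties using (length-toList)
  open import Function using (_∘_; id; _⇔_; Equivalence; mk⇔; case_of_)
  open import Level using (0ℓ)
  open import Relation.Binary using (StrictTotalOrder; tri<; tri≈; tri>)
  import Relation.Binary.Construct.On as On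
  open import Relation.Binary.Construct.Closure.ReflexiveTransitive using (ε; _◅_)
  open import Relation.Binary.Construct.Closure.Symmetric using (fwd; bwd)
  open import Relation.Binary.PropositionalEquality hiding ([_])
  open import Relation.Nullary using (Dec; does; yes; no; ¬_)
  open import Relation.Nullary.Decidable using (dec-true; dec-false)
  open import Relation.Nullary.Negation using (contradiction)
  open import Relation.Unary using (Decidable)

  private variable
    A B C : Set
    k n m r : ℕ

  ∑ : List A → (A → ℕ) → ℕ
  ∑ xs f = sum (map f xs)

  syntax ∑ xs (λ x → e) = ∑[ x ∈ xs ] e

  ∑-++ : (xs ys : List A) (f : A → ℕ) → ∑ (xs ++ ys) f ≡ ∑ xs f + ∑ ys f
  ∑-++ xs ys f = trans (cong sum (map-++ f xs ys)) (sum-++ (map f xs) (map f ys))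

  ∑-map : (g : A → B) (xs : List A) (f : B → ℕ) → ∑ (map g xs) f ≡ ∑ xs (f ∘ g)
  ∑-map g xs f = cong sum (sym (map-∘ xs))

  ∑-concatMap : (h : A → List B) (xs : List A) (f : B → ℕ) →
    ∑ (concatMap h xs) f ≡ ∑[ x ∈ xs ] ∑ (h x) f
  ∑-concatMap h []       f = refl
  ∑-concatMap h (x ∷ xs) f = trans (∑-++ (h x) (concatMap h xs) f) (cong (∑ (h x) f +_) (∑-concatMap h xs f))

  ∑-cong : (xs : List A) {f g : A → ℕ} → (∀ x → f x ≡ g x) → ∑ xs f ≡ ∑ xs g
  ∑-cong xs f≗g = cong sum (map-cong f≗g xs)

  ∑-cong-∈ : (xs : List A) {f g : A → ℕ} → (∀ {x} → x ∈ₗ xs → f x ≡ g x) → ∑ xs f ≡ ∑ xs g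
  ∑-cong-∈ xs f≗g = cong sum (map-cong-local (All.tabulate f≗g))

  ∑-+ : (xs : List A) (f g : A → ℕ) → ∑[ x ∈ xs ] (f x + g x) ≡ ∑ xs f + ∑ xs g
  ∑-+ []       f g = refl
  ∑-+ (x ∷ xs) f g = trans (cong (f x + g x +_) (∑-+ xs f g)) (+-interchange (f x) (g x) (∑ xs f) (∑ xs g))

  ∑-*ˡ : (xs : List A) (c : ℕ) (f : A → ℕ) → ∑[ x ∈ xs ] (c * f x) ≡ c * ∑ xs f
  ∑-*ˡ []       c f = sym (*-zeroʳ c)
  ∑-*ˡ (x ∷ xs) c f = trans (cong (c * f x +_) (∑-*ˡ xs c f)) (sym (*-distribˡ-+ c (f x) (∑ xs f)))

  ∑-const : (xs : List A) (c : ℕ) → ∑[ _ ∈ xs ] c ≡ length xs * c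
  ∑-const []       c = refl
  ∑-const (x ∷ xs) c = cong (c +_) (∑-const xs c)

  ∑-zero : (xs : List A) → ∑[ _ ∈ xs ] 0 ≡ 0
  ∑-zero xs = trans (∑-const xs 0) (*-zeroʳ (length xs))

  ∑-comm : (xs : List A) (ys : List B) (f : A → B → ℕ) →
    ∑[ x ∈ xs ] ∑ ys (f x) ≡ ∑[ y ∈ ys ] ∑[ x ∈ xs ] f x y
  ∑-comm []       ys f = sym (∑-zero ys)
  ∑-comm (x ∷ xs) ys f =
    trans (cong (∑ ys (f x) +_) (∑-comm xs ys f)) (sym (∑-+ ys (f x) (λ y → ∑[ x′ ∈ xs ] f x′ y)))

  ∑-cartesianProduct : (xs : List A) (ys : List B) (f : A × B → ℕ) →
    ∑ (cartesianProduct xs ys) f ≡ ∑[ x ∈ xs ] ∑[ y ∈ ys ] f (x , y)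
  ∑-cartesianProduct []       ys f = refl
  ∑-cartesianProduct (x ∷ xs) ys f = trans (∑-++ (map (x ,_) ys) _ f)
    (cong₂ _+_ (∑-map (x ,_) ys f) (∑-cartesianProduct xs ys f))

  𝟙 : Bool → ℕ
  𝟙 b = if b then 1 else 0

  𝟙-∧ : ∀ a b → 𝟙 (a ∧ b) ≡ 𝟙 a * 𝟙 b
  𝟙-∧ true  b = sym (+-identityʳ (𝟙 b))
  𝟙-∧ false b = refl

  does⇒ : ∀ {p} {P : Set p} (d : Dec P) → T (does d) → P
  does⇒ (yes p) _ = p

  ⇒does : ∀ {p} {P : Set p} (d : Dec P) → P → T (does d)
  ⇒does (yes _) _ = _
  ⇒does (no ¬p) p = ¬p p

  ∑-filter : {P : A → Set} (P? : ∀ x → Dec (P x)) (xs : List A) (f : A → ℕ) →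
    ∑ (filter P? xs) f ≡ ∑[ x ∈ xs ] (𝟙 (does (P? x)) * f x)
  ∑-filter P? []       f = refl
  ∑-filter P? (x ∷ xs) f with does (P? x)
  ... | true  = cong₂ _+_ (sym (+-identityʳ (f x))) (∑-filter P? xs f)
  ... | false = ∑-filter P? xs f

  ∑-upTo-suc : (k : ℕ) (f : ℕ → ℕ) → ∑ (upTo (suc k)) f ≡ f 0 + ∑ (upTo k) (f ∘ suc)
  ∑-upTo-suc k f = cong (f 0 +_) (trans (cong (λ xs → ∑ xs f) (sym (map-upTo suc k))) (∑-map suc (upTo k) f))

  ∑-upTo-cong : (k : ℕ) {f g : ℕ → ℕ} → (∀ {j} → j < k → f j ≡ g j) → ∑ (upTo k) f ≡ ∑ (upTo k) g
  ∑-upTo-cong k f≗g = ∑-cong-∈ (upTo k) (f≗g ∘ ∈-upTo⁻)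

  T-ext : ∀ {a b} → (T a → T b) → (T b → T a) → a ≡ b
  T-ext a⇒b b⇒a = ⇔→≡ {z = true}
    (mk⇔ (Equivalence.to T-≡ ∘ a⇒b ∘ Equivalence.from T-≡) (Equivalence.to T-≡ ∘ b⇒a ∘ Equivalence.from T-≡))

  AllPairs-∈ : ∀ {R : A → A → Set} {xs x y} → AllPairs R xs → x ∈ₗ xs → y ∈ₗ xs → x ≡ y ⊎ R x y ⊎ R y x
  AllPairs-∈ (Rx ∷ _)  (here refl) (here refl) = inj₁ refl
  AllPairs-∈ (Rx ∷ _)  (here refl) (there y∈)  = inj₂ (inj₁ (All.lookup Rx y∈))
  AllPairs-∈ (Rx ∷ _)  (there x∈)  (here refl) = inj₂ (inj₂ (All.lookup Rx x∈))
  AllPairs-∈ (_  ∷ Rs) (there x∈)  (there y∈)  = AllPairs-∈ Rs x∈ y∈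

  swapAt : ℕ → List A → List A
  swapAt zero    (x ∷ y ∷ xs) = y ∷ x ∷ xs
  swapAt (suc i) (x ∷ xs)     = x ∷ swapAt i xs
  swapAt _       xs           = xs

  swapAt-involutive : ∀ i (xs : List A) → swapAt i (swapAt i xs) ≡ xs
  swapAt-involutive zero    []           = refl
  swapAt-involutive zero    (x ∷ [])     = refl
  swapAt-involutive zero    (x ∷ y ∷ xs) = refl
  swapAt-involutive (suc i) []           = refl
  swapAt-involutive (suc i) (x ∷ xs)     = cong (x ∷_) (swapAt-involutive i xs)

  All-swapAt : {P : A → Set} → ∀ i {xs} → All P xs → All P (swapAt i xs)
  All-swapAt zero    []               = []
  All-swapAt zero    (px ∷ [])        = px ∷ []
  All-swapAt zero    (px ∷ py ∷ pxs)  = py ∷ px ∷ pxs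
  All-swapAt (suc i) []               = []
  All-swapAt (suc i) (px ∷ pxs)       = px ∷ All-swapAt i pxs

  Unique-swapAt : ∀ i {xs : List A} → Unique xs → Unique (swapAt i xs)
  Unique-swapAt zero    []                           = []
  Unique-swapAt zero    (_ ∷ [])                     = [] ∷ []
  Unique-swapAt zero    ((x≢y ∷ x≢) ∷ y≢ ∷ u)        = ((x≢y ∘ sym) ∷ y≢) ∷ x≢ ∷ u
  Unique-swapAt (suc i) []                           = []
  Unique-swapAt (suc i) (x≢ ∷ u)                     = All-swapAt i x≢ ∷ Unique-swapAt i u

  swapAtᵥ : ℕ → Vec A k → Vec A k
  swapAtᵥ zero    (x ∷ y ∷ xs) = y ∷ x ∷ xs
  swapAtᵥ (suc i) (x ∷ xs)     = x ∷ swapAtᵥ i xs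
  swapAtᵥ _       xs           = xs

  toList-swapAtᵥ : ∀ i (xs : Vec A k) → toList (swapAtᵥ i xs) ≡ swapAt i (toList xs)
  toList-swapAtᵥ zero    []           = refl
  toList-swapAtᵥ zero    (x ∷ [])     = refl
  toList-swapAtᵥ zero    (x ∷ y ∷ xs) = refl
  toList-swapAtᵥ (suc i) []           = refl
  toList-swapAtᵥ (suc i) (x ∷ xs)     = cong (x ∷_) (toList-swapAtᵥ i xs)

  ∑-allVecs-suc : ∀ n m (g : Vec (Fin m) (suc n) → ℕ) →
    ∑ (allVecs (suc n) m) g ≡ ∑[ v ∈ allVecs n m ] ∑[ x ∈ allFin m ] g (x ∷ v)
  ∑-allVecs-suc n m g = trans (∑-concatMap (λ v → map (_∷ v) (allFin m)) (allVecs n m) g)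
    (∑-cong (allVecs n m) (λ v → ∑-map (_∷ v) (allFin m) g))

  ∑-allVecs-swapAt : ∀ n m i (g : Vec (Fin m) n → ℕ) → ∑ (allVecs n m) (g ∘ swapAtᵥ i) ≡ ∑ (allVecs n m) g
  ∑-allVecs-swapAt zero          m zero    g = refl
  ∑-allVecs-swapAt zero          m (suc i) g = refl
  ∑-allVecs-swapAt (suc zero)    m zero    g = trans (∑-allVecs-suc 0 m _) (sym (∑-allVecs-suc 0 m g))
  ∑-allVecs-swapAt (suc (suc n)) m zero    g = begin
    ∑ (allVecs (suc (suc n)) m) (g ∘ swapAtᵥ 0)                          ≡⟨ ∑-allVecs-suc (suc n) m _ ⟩
    ∑[ v ∈ allVecs (suc n) m ] ∑[ x ∈ allFin m ] g (swapAtᵥ 0 (x ∷ v))   ≡⟨ ∑-allVecs-suc n m _ ⟩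
    ∑[ v ∈ allVecs n m ] ∑[ y ∈ allFin m ] ∑[ x ∈ allFin m ] g (y ∷ x ∷ v)
      ≡⟨ ∑-cong (allVecs n m) (λ v → ∑-comm (allFin m) (allFin m) (λ y x → g (y ∷ x ∷ v))) ⟩
    ∑[ v ∈ allVecs n m ] ∑[ x ∈ allFin m ] ∑[ y ∈ allFin m ] g (y ∷ x ∷ v) ≡⟨ ∑-allVecs-suc n m _ ⟨
    ∑[ v ∈ allVecs (suc n) m ] ∑[ y ∈ allFin m ] g (y ∷ v)              ≡⟨ ∑-allVecs-suc (suc n) m g ⟨
    ∑ (allVecs (suc (suc n)) m) g                                        ∎
    where open ≡-Reasoning
  ∑-allVecs-swapAt (suc n) m (suc i) g = begin
    ∑ (allVecs (suc n) m) (g ∘ swapAtᵥ (suc i))                  ≡⟨ ∑-allVecs-suc n m _ ⟩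
    ∑[ v ∈ allVecs n m ] ∑[ x ∈ allFin m ] g (x ∷ swapAtᵥ i v)
      ≡⟨ ∑-allVecs-swapAt n m i (λ v → ∑[ x ∈ allFin m ] g (x ∷ v)) ⟩
    ∑[ v ∈ allVecs n m ] ∑[ x ∈ allFin m ] g (x ∷ v)             ≡⟨ ∑-allVecs-suc n m g ⟨
    ∑ (allVecs (suc n) m) g                                      ∎
    where open ≡-Reasoning

  isPerm : Vec (Fin n) n → Bool
  isPerm ω = does (unique? _≟ᶠ_ (toList ω))

  isPerm-swapAt : ∀ i (ω : Vec (Fin n) n) → isPerm (swapAtᵥ i ω) ≡ isPerm ω
  isPerm-swapAt i ω with unique? _≟ᶠ_ (toList ω)
  ... | yes u = dec-true (unique? _≟ᶠ_ _) (subst Unique (sym (toList-swapAtᵥ i ω)) (Unique-swapAt i u))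
  ... | no ¬u = dec-false (unique? _≟ᶠ_ _) λ u → ¬u (subst Unique (swapAt-involutive i (toList ω))
    (Unique-swapAt i (subst Unique (toList-swapAtᵥ i ω) u)))

  ∑-Perms-swapAt : ∀ n i (g : Vec (Fin n) n → ℕ) → ∑ (Perms n) (g ∘ swapAtᵥ i) ≡ ∑ (Perms n) g
  ∑-Perms-swapAt n i g = begin
    ∑ (Perms n) (g ∘ swapAtᵥ i)                                          ≡⟨ ∑-filter _ (allVecs n n) _ ⟩
    ∑[ ω ∈ allVecs n n ] (𝟙 (isPerm ω) * g (swapAtᵥ i ω))
      ≡⟨ ∑-cong (allVecs n n) (λ ω → cong (λ b → 𝟙 b * g (swapAtᵥ i ω)) (sym (isPerm-swapAt i ω))) ⟩
    ∑[ ω ∈ allVecs n n ] (𝟙 (isPerm (swapAtᵥ i ω)) * g (swapAtᵥ i ω))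
      ≡⟨ ∑-allVecs-swapAt n n i (λ ω → 𝟙 (isPerm ω) * g ω) ⟩
    ∑[ ω ∈ allVecs n n ] (𝟙 (isPerm ω) * g ω)                            ≡⟨ ∑-filter _ (allVecs n n) g ⟨
    ∑ (Perms n) g                                                        ∎
    where open ≡-Reasoning

  swapAtᶜ : ℕ → ColPerm n r → ColPerm n r
  swapAtᶜ i (ω , τ) = swapAtᵥ i ω , swapAtᵥ i τ

  ∑-S : ∀ n r (F : ColPerm n r → ℕ) → ∑ (S n r) F ≡ ∑[ ω ∈ Perms n ] ∑[ τ ∈ allVecs n r ] F (ω , τ)
  ∑-S n r = ∑-cartesianProduct (Perms n) (allVecs n r)

  ∑-S-swapAt : ∀ n r i (F : ColPerm n r → ℕ) → ∑ (S n r) (F ∘ swapAtᶜ i) ≡ ∑ (S n r) F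
  ∑-S-swapAt n r i F = begin
    ∑ (S n r) (F ∘ swapAtᶜ i)                                       ≡⟨ ∑-S n r _ ⟩
    ∑[ ω ∈ Perms n ] ∑[ τ ∈ allVecs n r ] F (swapAtᵥ i ω , swapAtᵥ i τ)
      ≡⟨ ∑-cong (Perms n) (λ ω → ∑-allVecs-swapAt n r i (λ τ → F (swapAtᵥ i ω , τ))) ⟩
    ∑[ ω ∈ Perms n ] ∑[ τ ∈ allVecs n r ] F (swapAtᵥ i ω , τ)
      ≡⟨ ∑-Perms-swapAt n i (λ ω → ∑[ τ ∈ allVecs n r ] F (ω , τ)) ⟩
    ∑[ ω ∈ Perms n ] ∑[ τ ∈ allVecs n r ] F (ω , τ)                ≡⟨ ∑-S n r F ⟨
    ∑ (S n r) F                                                     ∎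
    where open ≡-Reasoning

  ∑-S-colouring : ∀ n r (g : Vec (Fin r) n → ℕ) → ∑[ σ ∈ S n r ] g (proj₂ σ) ≡ length (Perms n) * ∑ (allVecs n r) g
  ∑-S-colouring n r g = trans (∑-S n r (g ∘ proj₂)) (∑-const (Perms n) (∑ (allVecs n r) g))

  ∈S⇒Unique : ∀ {σ : ColPerm n r} → σ ∈ₗ S n r → Unique (toList (proj₁ σ))
  ∈S⇒Unique {n} {r} σ∈ = proj₂ (∈-filter⁻ (λ v → unique? _≟ᶠ_ (toList v)) {xs = allVecs n n}
    (proj₁ (∈-cartesianProduct⁻ (Perms n) (allVecs n r) σ∈)))

  -- Insertion into decreasing lists

  insertAt : List A → ℕ → A → List A
  insertAt xs       zero    v = v ∷ xs
  insertAt []       (suc i) v = v ∷ []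
  insertAt (x ∷ xs) (suc i) v = x ∷ insertAt xs i v

  lookupOr : List A → ℕ → A → A
  lookupOr []       _       d = d
  lookupOr (x ∷ _)  zero    _ = x
  lookupOr (_ ∷ xs) (suc p) d = lookupOr xs p d

  private
    -- u, v and p stand for y ⊏ b, z ⊏ b and z ⊏ y; the hypotheses are transitivity.
    insertion-weight : ∀ u v p D → (T p → T u → T v) → (T (not p) → T v → T u) →
      𝟙 (u ∧ p ∧ D) + 𝟙 v * 𝟙 (not p ∧ D) ≡ 𝟙 (u ∧ v ∧ D)
    insertion-weight true  true  true  D _ _ = +-identityʳ (𝟙 D)
    insertion-weight true  false true  D h _ = ⊥-elim (h _ _)
    insertion-weight false true  true  D _ _ = refl
    insertion-weight false false true  D _ _ = refl
    insertion-weight true  true  false D _ _ = +-identityʳ (𝟙 D)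
    insertion-weight true  false false D _ _ = refl
    insertion-weight false true  false D _ h = ⊥-elim (h _ _)
    insertion-weight false false false D _ _ = refl

  module DescendingLists {ℓ₁ ℓ₂} (O : StrictTotalOrder 0ℓ ℓ₁ ℓ₂) where

    open StrictTotalOrder O using (Carrier; _≈_; compare)
      renaming (_<_ to _⊏_; _<?_ to _⊏?_; asym to ⊏-asym; trans to ⊏-trans)

    descending : List Carrier → Bool
    descending (x ∷ y ∷ xs) = does (y ⊏? x) ∧ descending (y ∷ xs)
    descending _            = true

    private
      lt : Carrier → Carrier → Bool
      lt x y = does (x ⊏? y)

      lt⇒⊏ : ∀ {x y} → T (lt x y) → x ⊏ y
      lt⇒⊏ {x} {y} = does⇒ (x ⊏? y)

      ⊏⇒lt : ∀ {x y} → x ⊏ y → T (lt x y)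
      ⊏⇒lt {x} {y} = ⇒does (x ⊏? y)

      lt-trans : ∀ {x y z} → T (lt x y) → T (lt y z) → T (lt x z)
      lt-trans x⊏y y⊏z = ⊏⇒lt (⊏-trans (lt⇒⊏ x⊏y) (lt⇒⊏ y⊏z))

      lt-flip : ∀ {y z} → ¬ y ≈ z → lt y z ≡ not (lt z y)
      lt-flip {y} {z} y≉z with y ⊏? z | z ⊏? y
      ... | yes y⊏z | yes z⊏y = contradiction z⊏y (⊏-asym y⊏z)
      ... | yes _   | no  _   = refl
      ... | no  _   | yes _   = refl
      ... | no  y⋢z | no  z⋢y with compare y z
      ...   | tri< y⊏z _   _   = contradiction y⊏z y⋢z
      ...   | tri≈ _   y≈z _   = contradiction y≈z y≉z
      ...   | tri> _   _   z⊏y = contradiction z⊏y z⋢y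

    ∑-insertAt-below : ∀ b y ys → All (λ z → ¬ y ≈ z) ys →
      ∑[ j ∈ upTo (suc (length ys)) ] 𝟙 (descending (b ∷ insertAt ys j y)) ≡ 𝟙 (does (y ⊏? b) ∧ descending (b ∷ ys))
    ∑-insertAt-below b y []       []           = +-identityʳ _
    ∑-insertAt-below b y (z ∷ zs) (y≉z ∷ y≉zs) = begin
      ∑[ j ∈ upTo (suc (length (z ∷ zs))) ] 𝟙 (descending (b ∷ insertAt (z ∷ zs) j y))
        ≡⟨ ∑-upTo-suc (suc (length zs)) (λ j → 𝟙 (descending (b ∷ insertAt (z ∷ zs) j y))) ⟩
      𝟙 (u ∧ p ∧ D) + ∑[ j ∈ upTo (suc (length zs)) ] 𝟙 (v ∧ descending (z ∷ insertAt zs j y))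
        ≡⟨ cong (𝟙 (u ∧ p ∧ D) +_) (trans (∑-cong (upTo (suc (length zs))) (λ j → 𝟙-∧ v (descending (z ∷ insertAt zs j y))))
                                        (∑-*ˡ (upTo (suc (length zs))) (𝟙 v) (λ j → 𝟙 (descending (z ∷ insertAt zs j y))))) ⟩
      𝟙 (u ∧ p ∧ D) + 𝟙 v * ∑[ j ∈ upTo (suc (length zs)) ] 𝟙 (descending (z ∷ insertAt zs j y))
        ≡⟨ cong (λ k → 𝟙 (u ∧ p ∧ D) + 𝟙 v * k) (∑-insertAt-below z y zs y≉zs) ⟩
      𝟙 (u ∧ p ∧ D) + 𝟙 v * 𝟙 (lt y z ∧ D)
        ≡⟨ cong (λ q → 𝟙 (u ∧ p ∧ D) + 𝟙 v * 𝟙 (q ∧ D)) (lt-flip y≉z) ⟩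
      𝟙 (u ∧ p ∧ D) + 𝟙 v * 𝟙 (not p ∧ D)
        ≡⟨ insertion-weight u v p D lt-trans (λ y⊏z z⊏b → lt-trans (subst T (sym (lt-flip y≉z)) y⊏z) z⊏b) ⟩
      𝟙 (u ∧ v ∧ D) ∎
      where
      open ≡-Reasoning
      u v p D : Bool
      u = lt y b
      v = lt z b
      p = lt z y
      D = descending (z ∷ zs)

    ∑-insertAt-descending : ∀ y ys → All (λ z → ¬ y ≈ z) ys →
      ∑[ j ∈ upTo (suc (length ys)) ] 𝟙 (descending (insertAt ys j y)) ≡ 𝟙 (descending ys)
    ∑-insertAt-descending y []       []           = refl
    ∑-insertAt-descending y (z ∷ zs) (y≉z ∷ y≉zs) = begin
      ∑[ j ∈ upTo (suc (length (z ∷ zs))) ] 𝟙 (descending (insertAt (z ∷ zs) j y))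
        ≡⟨ ∑-upTo-suc (suc (length zs)) (λ j → 𝟙 (descending (insertAt (z ∷ zs) j y))) ⟩
      𝟙 (p ∧ D) + ∑[ j ∈ upTo (suc (length zs)) ] 𝟙 (descending (z ∷ insertAt zs j y))
        ≡⟨ cong (𝟙 (p ∧ D) +_) (∑-insertAt-below z y zs y≉zs) ⟩
      𝟙 (p ∧ D) + 𝟙 (lt y z ∧ D)
        ≡⟨ cong (λ q → 𝟙 (p ∧ D) + q) (trans (cong (λ q → 𝟙 (q ∧ D)) (lt-flip y≉z)) (sym (*-identityˡ _))) ⟩
      𝟙 (p ∧ D) + 1 * 𝟙 (not p ∧ D)
        ≡⟨ insertion-weight true true p D _ _ ⟩
      𝟙 D ∎
      where
      open ≡-Reasoning
      p D : Bool
      p = lt z y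
      D = descending (z ∷ zs)

    descending⁻ : ∀ l d → T (descending l) → ∀ {i} → suc i < length l → lookupOr l (suc i) d ⊏ lookupOr l i d
    descending⁻ (x ∷ [])    d t {zero}  (s≤s ())
    descending⁻ (x ∷ y ∷ l) d t {zero}  _       = lt⇒⊏ (proj₁ (Equivalence.to T-∧ t))
    descending⁻ (x ∷ y ∷ l) d t {suc i} (s≤s h) = descending⁻ (y ∷ l) d (proj₂ (Equivalence.to T-∧ t)) h

    descending⁺ : ∀ l d → (∀ {i} → suc i < length l → lookupOr l (suc i) d ⊏ lookupOr l i d) → T (descending l)
    descending⁺ []          d h = _
    descending⁺ (x ∷ [])    d h = _
    descending⁺ (x ∷ y ∷ l) d h =
      Equivalence.from T-∧ (⊏⇒lt (h (s≤s (s≤s z≤n))) , descending⁺ (y ∷ l) d (h ∘ s≤s))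

  symbol : Fin n → Fin r → ℕ × ℕ
  symbol x c = suc (toℕ x) , toℕ c

  symbols : ColPerm n r → List (ℕ × ℕ)
  symbols (ω , τ) = toList (Vec.zipWith symbol ω τ)

  toList-zipWith : (f : A → B → C) (xs : Vec A k) (ys : Vec B k) →
    toList (Vec.zipWith f xs ys) ≡ zipWith f (toList xs) (toList ys)
  toList-zipWith f []       []       = refl
  toList-zipWith f (x ∷ xs) (y ∷ ys) = cong (f x y ∷_) (toList-zipWith f xs ys)

  module _ (d : ℕ × ℕ) (go : ℕ → List (Fin n) → List (Fin r) → ℕ × ℕ)
    (go-0∷∷ : ∀ x xs c cs → go 0 (x ∷ xs) (c ∷ cs) ≡ symbol x c)
    (go-s∷∷ : ∀ p x xs c cs → go (suc p) (x ∷ xs) (c ∷ cs) ≡ go p xs cs)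
    (go-0[] : ∀ cs → go 0 [] cs ≡ d) (go-s[] : ∀ p cs → go (suc p) [] cs ≡ d)
    (go-0∷[] : ∀ x xs → go 0 (x ∷ xs) [] ≡ d) (go-s∷[] : ∀ p x xs → go (suc p) (x ∷ xs) [] ≡ d) where

    go≡lookupOr : ∀ p xs cs → go p xs cs ≡ lookupOr (zipWith symbol xs cs) p d
    go≡lookupOr zero    []       cs       = go-0[] cs
    go≡lookupOr (suc p) []       cs       = go-s[] p cs
    go≡lookupOr zero    (x ∷ xs) []       = go-0∷[] x xs
    go≡lookupOr (suc p) (x ∷ xs) []       = go-s∷[] p x xs
    go≡lookupOr zero    (x ∷ xs) (c ∷ cs) = go-0∷∷ x xs c cs
    go≡lookupOr (suc p) (x ∷ xs) (c ∷ cs) = trans (go-s∷∷ p x xs c cs) (go≡lookupOr p xs cs)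

  -- The local function go of symbolAt cannot be named. It is lambda-lifted over the clause
  -- variables, the position among them, so that occurrence of the position is generalised
  -- to o first; symbolAt-go is then solved by unification.
  mutual
    symbolAt-go : Vec (Fin n) n → Vec (Fin r) n → ℕ → ℕ → List (Fin n) → List (Fin r) → ℕ × ℕ
    symbolAt-go = _

    symbolAt≡lookupOr : (σ : ColPerm n r) (p : ℕ) → symbolAt σ p ≡ lookupOr (symbols σ) p (suc n , 0)
    symbolAt≡lookupOr {n} (ω , τ) p =
      trans (symbolAt-zipWith p) (cong (λ l → lookupOr l p (suc n , 0)) (sym (toList-zipWith symbol ω τ)))
      where
      symbolAt-zipWith : ∀ p → symbolAt (ω , τ) p ≡ lookupOr (zipWith symbol (toList ω) (toList τ)) p (suc n , 0)
      symbolAt-zipWith zero with toList ω | toList τ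
      ... | []    | _     = refl
      ... | _ ∷ _ | []    = refl
      ... | _ ∷ _ | _ ∷ _ = refl
      symbolAt-zipWith (suc p) with toList ω | toList τ
      ... | []     | _      = refl
      ... | _ ∷ _  | []     = refl
      ... | _ ∷ xs | _ ∷ cs with suc p
      ...   | o = go≡lookupOr (suc n , 0) (symbolAt-go ω τ o) (λ _ _ _ _ → refl) (λ _ _ _ _ _ → refl)
                    (λ _ → refl) (λ _ _ → refl) (λ _ _ → refl) (λ _ _ _ → refl) p xs cs

  zipWith-swapAtᵥ : (f : A → B → C) → ∀ i (xs : Vec A k) (ys : Vec B k) →
    Vec.zipWith f (swapAtᵥ i xs) (swapAtᵥ i ys) ≡ swapAtᵥ i (Vec.zipWith f xs ys)
  zipWith-swapAtᵥ f zero    []            []            = refl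
  zipWith-swapAtᵥ f zero    (x ∷ [])      (y ∷ [])      = refl
  zipWith-swapAtᵥ f zero    (x ∷ x′ ∷ xs) (y ∷ y′ ∷ ys) = refl
  zipWith-swapAtᵥ f (suc i) []            []            = refl
  zipWith-swapAtᵥ f (suc i) (x ∷ xs)      (y ∷ ys)      = cong (f x y ∷_) (zipWith-swapAtᵥ f i xs ys)

  symbols-swapAt : ∀ i (σ : ColPerm n r) → symbols (swapAtᶜ i σ) ≡ swapAt i (symbols σ)
  symbols-swapAt i (ω , τ) = trans (cong toList (zipWith-swapAtᵥ symbol i ω τ)) (toList-swapAtᵥ i (Vec.zipWith symbol ω τ))

  length-symbols : (σ : ColPerm n r) → length (symbols σ) ≡ n
  length-symbols (ω , τ) = length-toList (Vec.zipWith symbol ω τ)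

  module _ {f : A → B → C} (f-injectiveˡ : ∀ {x x′ y y′} → f x y ≡ f x′ y′ → x ≡ x′) where

    All-≢-zipWith : ∀ {x y} (xs : Vec A k) (ys : Vec B k) →
      All (x ≢_) (toList xs) → All (f x y ≢_) (toList (Vec.zipWith f xs ys))
    All-≢-zipWith []        []        []             = []
    All-≢-zipWith (x′ ∷ xs) (y′ ∷ ys) (x≢x′ ∷ x≢xs) = (x≢x′ ∘ f-injectiveˡ) ∷ All-≢-zipWith xs ys x≢xs

    Unique-zipWith : (xs : Vec A k) (ys : Vec B k) → Unique (toList xs) → Unique (toList (Vec.zipWith f xs ys))
    Unique-zipWith []       []       []        = []
    Unique-zipWith (x ∷ xs) (y ∷ ys) (x∉ ∷ u) = All-≢-zipWith xs ys x∉ ∷ Unique-zipWith xs ys u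

  Unique-symbols : (σ : ColPerm n r) → Unique (toList (proj₁ σ)) → Unique (symbols σ)
  Unique-symbols (ω , τ) = Unique-zipWith (λ eq → toℕ-injective (suc-injective (cong proj₁ eq))) ω τ

  moveDown : ℕ → ℕ → List A → List A
  moveDown a zero    xs = xs
  moveDown a (suc d) xs = swapAt a (moveDown (suc a) d xs)

  moveDownᶜ : ℕ → ℕ → ColPerm n r → ColPerm n r
  moveDownᶜ a zero    σ = σ
  moveDownᶜ a (suc d) σ = swapAtᶜ a (moveDownᶜ (suc a) d σ)

  symbols-moveDown : ∀ a d (σ : ColPerm n r) → symbols (moveDownᶜ a d σ) ≡ moveDown a d (symbols σ)
  symbols-moveDown a zero    σ = refl
  symbols-moveDown a (suc d) σ = trans (symbols-swapAt a (moveDownᶜ (suc a) d σ)) (cong (swapAt a) (symbols-moveDown (suc a) d σ))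

  ∑-S-moveDown : ∀ n r a d (F : ColPerm n r → ℕ) → ∑ (S n r) (F ∘ moveDownᶜ a d) ≡ ∑ (S n r) F
  ∑-S-moveDown n r a zero    F = refl
  ∑-S-moveDown n r a (suc d) F = trans (∑-S-moveDown n r (suc a) d (F ∘ swapAtᶜ a)) (∑-S-swapAt n r a F)

  moveDown-∷ : ∀ a d x (xs : List A) → moveDown (suc a) d (x ∷ xs) ≡ x ∷ moveDown a d xs
  moveDown-∷ a zero    x xs = refl
  moveDown-∷ a (suc d) x xs = cong (swapAt (suc a)) (moveDown-∷ (suc a) d x xs)

  moveDown-++ : ∀ (pre : List A) a d xs → moveDown (length pre + a) d (pre ++ xs) ≡ pre ++ moveDown a d xs
  moveDown-++ []        a d xs = refl
  moveDown-++ (x ∷ pre) a d xs = trans (moveDown-∷ (length pre + a) d x (pre ++ xs)) (cong (x ∷_) (moveDown-++ pre a d xs))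

  moveDown-insertAt : ∀ j d (ys : List A) y post → length ys ≡ j + d →
    moveDown j d (ys ++ y ∷ post) ≡ insertAt ys j y ++ post
  moveDown-insertAt zero    zero    []       y post _  = refl
  moveDown-insertAt zero    (suc d) (z ∷ zs) y post eq = cong (swapAt 0)
    (trans (moveDown-∷ 0 d z (zs ++ y ∷ post)) (cong (z ∷_) (moveDown-insertAt zero d zs y post (suc-injective eq))))
  moveDown-insertAt (suc j) d       (z ∷ zs) y post eq =
    trans (moveDown-∷ j d z (zs ++ y ∷ post)) (cong (z ∷_) (moveDown-insertAt j d zs y post (suc-injective eq)))

  lookupOr-drop : ∀ m (xs : List A) i d → lookupOr (drop m xs) i d ≡ lookupOr xs (m + i) d
  lookupOr-drop zero    xs       i d = refl
  lookupOr-drop (suc m) []       i d = refl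
  lookupOr-drop (suc m) (x ∷ xs) i d = lookupOr-drop m xs i d

  lookupOr-≥ : ∀ (xs : List A) {p} d → length xs ≤ p → lookupOr xs p d ≡ d
  lookupOr-≥ []       d _       = refl
  lookupOr-≥ (x ∷ xs) d (s≤s h) = lookupOr-≥ xs d h

  lookupOr-∈ : ∀ (xs : List A) {p} d → p < length xs → lookupOr xs p d ∈ₗ xs
  lookupOr-∈ (x ∷ xs) {zero}  d _       = here refl
  lookupOr-∈ (x ∷ xs) {suc p} d (s≤s h) = there (lookupOr-∈ xs d h)

  lookupOr-take : ∀ k (xs : List A) {i} d → i < k → lookupOr (take k xs) i d ≡ lookupOr xs i d
  lookupOr-take (suc k) []       d _       = refl
  lookupOr-take (suc k) (x ∷ xs) {zero}  d _       = refl
  lookupOr-take (suc k) (x ∷ xs) {suc i} d (s≤s h) = lookupOr-take k xs d h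

  symbolAt-end : (σ : ColPerm n r) → symbolAt σ n ≡ (suc n , 0)
  symbolAt-end {n} σ = trans (symbolAt≡lookupOr σ n) (lookupOr-≥ (symbols σ) _ (≤-reflexive (length-symbols σ)))

  values≤ : (ω : Vec (Fin n) k) (τ : Vec (Fin r) k) → All (λ s → proj₁ s ≤ n) (toList (Vec.zipWith symbol ω τ))
  values≤ []      []      = []
  values≤ (x ∷ ω) (c ∷ τ) = toℕ<n x ∷ values≤ ω τ

  symbolAt-value≤ : (σ : ColPerm n r) → ∀ {p} → p < n → proj₁ (symbolAt σ p) ≤ n
  symbolAt-value≤ {n} σ@(ω , τ) {p} p<n = subst (λ s → proj₁ s ≤ n) (sym (symbolAt≡lookupOr σ p))
    (All.lookup (values≤ ω τ) (lookupOr-∈ (symbols σ) _ (subst (p <_) (sym (length-symbols σ)) p<n)))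

  -- Decreasing blocks

  -- Definitionally Defs._≺_: colours are compared first, then values.
  symbolOrder : StrictTotalOrder _ _ _
  symbolOrder = On.strictTotalOrder (×-strictTotalOrder <-strictTotalOrder <-strictTotalOrder) swap

  open DescendingLists symbolOrder

  block : ℕ → ℕ → List A → List A
  block lo len xs = take len (drop lo xs)

  block-++ : ∀ (pre mid post : List A) → block (length pre) (length mid) (pre ++ mid ++ post) ≡ mid
  block-++ []        []        post = refl
  block-++ []        (x ∷ mid) post = cong (x ∷_) (block-++ [] mid post)
  block-++ (x ∷ pre) mid       post = block-++ pre mid post

  block-split : ∀ lo k (xs : List A) → lo + k < length xs →
    ∃₂ λ y post → xs ≡ take lo xs ++ block lo k xs ++ y ∷ post
  block-split (suc lo) k       (x ∷ xs) (s≤s h) with block-split lo k xs h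
  ... | y , post , eq = y , post , cong (x ∷_) eq
  block-split zero     zero    (x ∷ xs) _       = x , xs , refl
  block-split zero     (suc k) (x ∷ xs) (s≤s h) with block-split zero k xs h
  ... | y , post , eq = y , post , cong (x ∷_) eq

  length-take-≤ : ∀ k (xs : List A) → k ≤ length xs → length (take k xs) ≡ k
  length-take-≤ k xs k≤ = trans (length-take k xs) (m≤n⇒m⊓n≡m k≤)

  length-block : ∀ lo k (xs : List A) → lo + k ≤ length xs → length (block lo k xs) ≡ k
  length-block lo k xs h = length-take-≤ k (drop lo xs)
    (subst (k ≤_) (sym (length-drop lo xs)) (subst (_≤ length xs ∸ lo) (m+n∸m≡n lo k) (∸-monoˡ-≤ lo h)))

  Unique-middle : ∀ (pre ys : List A) y post → Unique (pre ++ ys ++ y ∷ post) → All (y ≢_) ys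
  Unique-middle (x ∷ pre) ys       y post (_ ∷ u)   = Unique-middle pre ys y post u
  Unique-middle []        []       y post _         = []
  Unique-middle []        (z ∷ zs) y post (z∉ ∷ u) =
    (All.lookup z∉ (∈-++⁺ʳ zs (here refl)) ∘ sym) ∷ Unique-middle [] zs y post u

  length-insertAt : ∀ (ys : List A) j y → length (insertAt ys j y) ≡ suc (length ys)
  length-insertAt ys       zero    y = refl
  length-insertAt []       (suc j) y = refl
  length-insertAt (z ∷ ys) (suc j) y = cong suc (length-insertAt ys j y)

  ≢⇒≉ : ∀ {y z : ℕ × ℕ} → y ≢ z → ¬ StrictTotalOrder._≈_ symbolOrder y z
  ≢⇒≉ y≢z y≈z = y≢z (cong swap (≡×≡⇒≡ y≈z))

  ∑-descending-moveDown : ∀ {lo k} xs (pre ys : List (ℕ × ℕ)) y post → xs ≡ pre ++ ys ++ y ∷ post →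
    length pre ≡ lo → length ys ≡ k → All (y ≢_) ys →
    ∑[ j ∈ upTo (suc k) ] 𝟙 (descending (block lo (suc k) (moveDown (lo + j) (k ∸ j) xs))) ≡ 𝟙 (descending (block lo k xs))
  ∑-descending-moveDown _ pre ys y post refl refl refl y∉ys = begin
    ∑[ j ∈ upTo (suc (length ys)) ] 𝟙 (descending (block (length pre) (suc (length ys))
                                       (moveDown (length pre + j) (length ys ∸ j) (pre ++ ys ++ y ∷ post))))
      ≡⟨ ∑-upTo-cong (suc (length ys)) (cong (𝟙 ∘ descending) ∘ block-moveDown) ⟩
    ∑[ j ∈ upTo (suc (length ys)) ] 𝟙 (descending (insertAt ys j y))
      ≡⟨ ∑-insertAt-descending y ys (All.map ≢⇒≉ y∉ys) ⟩
    𝟙 (descending ys)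
      ≡⟨ cong (𝟙 ∘ descending) (block-++ pre ys (y ∷ post)) ⟨
    𝟙 (descending (block (length pre) (length ys) (pre ++ ys ++ y ∷ post))) ∎
    where
    open ≡-Reasoning
    block-moveDown : ∀ {j} → j < suc (length ys) →
      block (length pre) (suc (length ys)) (moveDown (length pre + j) (length ys ∸ j) (pre ++ ys ++ y ∷ post)) ≡ insertAt ys j y
    block-moveDown {j} (s≤s j≤k) = begin
      block (length pre) (suc (length ys)) (moveDown (length pre + j) (length ys ∸ j) (pre ++ ys ++ y ∷ post))
        ≡⟨ cong (block (length pre) (suc (length ys))) (moveDown-++ pre j (length ys ∸ j) (ys ++ y ∷ post)) ⟩
      block (length pre) (suc (length ys)) (pre ++ moveDown j (length ys ∸ j) (ys ++ y ∷ post))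
        ≡⟨ cong (λ l → block (length pre) (suc (length ys)) (pre ++ l))
                (moveDown-insertAt j (length ys ∸ j) ys y post (sym (m+[n∸m]≡n j≤k))) ⟩
      block (length pre) (suc (length ys)) (pre ++ insertAt ys j y ++ post)
        ≡⟨ cong (λ m → block (length pre) m (pre ++ insertAt ys j y ++ post)) (sym (length-insertAt ys j y)) ⟩
      block (length pre) (length (insertAt ys j y)) (pre ++ insertAt ys j y ++ post)
        ≡⟨ block-++ pre (insertAt ys j y) post ⟩
      insertAt ys j y ∎

  descendingBlock : ℕ → ℕ → ColPerm n r → Bool
  descendingBlock lo len σ = descending (block lo len (symbols σ))

  descendingBlock-moveDown : ∀ lo k (σ : ColPerm n r) → Unique (toList (proj₁ σ)) → lo + k < n →
    ∑[ j ∈ upTo (suc k) ] 𝟙 (descendingBlock lo (suc k) (moveDownᶜ (lo + j) (k ∸ j) σ)) ≡ 𝟙 (descendingBlock lo k σ)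
  descendingBlock-moveDown {n} lo k σ ω-unique lo+k<n
    with block-split lo k (symbols σ) (subst (lo + k <_) (sym (length-symbols σ)) lo+k<n)
  ... | y , post , eq = trans
    (∑-cong (upTo (suc k)) (λ j → cong (𝟙 ∘ descending ∘ block lo (suc k)) (symbols-moveDown (lo + j) (k ∸ j) σ)))
    (∑-descending-moveDown (symbols σ) (take lo (symbols σ)) (block lo k (symbols σ)) y post eq
      (length-take-≤ lo (symbols σ) (≤-trans (m≤m+n lo k) lo+k≤))
      (length-block lo k (symbols σ) lo+k≤)
      (Unique-middle (take lo (symbols σ)) (block lo k (symbols σ)) y post (subst Unique eq (Unique-symbols σ ω-unique))))
    where
    lo+k≤ : lo + k ≤ length (symbols σ)
    lo+k≤ = subst (lo + k ≤_) (sym (length-symbols σ)) (<⇒≤ lo+k<n)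

  Descent : ColPerm n r → ℕ → Set
  Descent σ p = symbolAt σ (suc p) ≺ symbolAt σ p

  symbolAt-block : ∀ lo len (σ : ColPerm n r) {i} → i < len →
    lookupOr (block lo len (symbols σ)) i (suc n , 0) ≡ symbolAt σ (lo + i)
  symbolAt-block lo len σ {i} i<len = trans (lookupOr-take len (drop lo (symbols σ)) _ i<len)
    (trans (lookupOr-drop lo (symbols σ) i _) (sym (symbolAt≡lookupOr σ (lo + i))))

  descendingBlock⁻ : ∀ lo len (σ : ColPerm n r) → lo + len ≤ n → T (descendingBlock lo len σ) →
    ∀ {i} → suc i < len → Descent σ (lo + i)
  descendingBlock⁻ {n} lo len σ lo+len≤n desc {i} 1+i<len =
    subst₂ _≺_ (trans (symbolAt-block lo len σ 1+i<len) (cong (symbolAt σ) (+-suc lo i)))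
               (symbolAt-block lo len σ (<-trans (n<1+n i) 1+i<len))
      (descending⁻ (block lo len (symbols σ)) (suc n , 0) desc (subst (suc i <_) (sym (length-block lo len (symbols σ) bound)) 1+i<len))
    where
    bound : lo + len ≤ length (symbols σ)
    bound = subst (lo + len ≤_) (sym (length-symbols σ)) lo+len≤n

  descendingBlock⁺ : ∀ lo len (σ : ColPerm n r) → lo + len ≤ n → (∀ {i} → suc i < len → Descent σ (lo + i)) →
    T (descendingBlock lo len σ)
  descendingBlock⁺ {n} lo len σ lo+len≤n descents = descending⁺ (block lo len (symbols σ)) (suc n , 0) λ {i} 1+i<blk →
    let 1+i<len = subst (suc i <_) (length-block lo len (symbols σ) bound) 1+i<blk in
    subst₂ _≺_ (sym (trans (symbolAt-block lo len σ 1+i<len) (cong (symbolAt σ) (+-suc lo i))))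
               (sym (symbolAt-block lo len σ (<-trans (n<1+n i) 1+i<len)))
      (descents 1+i<len)
    where
    bound : lo + len ≤ length (symbols σ)
    bound = subst (lo + len ≤_) (sym (length-symbols σ)) lo+len≤n

  count : (ColPerm n r → Bool) → ℕ
  count {n} {r} H = ∑[ σ ∈ S n r ] 𝟙 (H σ)

  count-cong : {H G : ColPerm n r → Bool} → (∀ σ → H σ ≡ G σ) → count H ≡ count G
  count-cong {n} {r} H≗G = ∑-cong (S n r) (cong 𝟙 ∘ H≗G)

  SwapInvariantOn : (ColPerm n r → Bool) → ℕ → ℕ → Set
  SwapInvariantOn H lo hi = ∀ {i} σ → lo ≤ i → suc i < hi → H (swapAtᶜ i σ) ≡ H σ

  SwapInvariantOn-∧ : ∀ {H G : ColPerm n r → Bool} {lo hi} → SwapInvariantOn H lo hi → SwapInvariantOn G lo hi →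
    SwapInvariantOn (λ σ → H σ ∧ G σ) lo hi
  SwapInvariantOn-∧ H-inv G-inv σ lo≤i i<hi = cong₂ _∧_ (H-inv σ lo≤i i<hi) (G-inv σ lo≤i i<hi)

  moveDown-invariant : ∀ {H : ColPerm n r → Bool} {lo hi} → SwapInvariantOn H lo hi →
    ∀ {a} d σ → lo ≤ a → a + d < hi → H (moveDownᶜ a d σ) ≡ H σ
  moveDown-invariant H-inv         zero    σ lo≤a a<hi = refl
  moveDown-invariant {lo = lo} {hi} H-inv {a} (suc d) σ lo≤a a+d<hi =
    trans (H-inv (moveDownᶜ (suc a) d σ) lo≤a (≤-<-trans (s≤s (m≤m+n a d)) sa+d<hi))
          (moveDown-invariant H-inv d σ (≤-trans lo≤a (n≤1+n a)) sa+d<hi)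
    where
    sa+d<hi : suc a + d < hi
    sa+d<hi = subst (_< hi) (+-suc a d) a+d<hi

  count-descendingBlock-suc : ∀ {H : ColPerm n r → Bool} lo k → lo + k < n → SwapInvariantOn H lo (lo + suc k) →
    count (λ σ → H σ ∧ descendingBlock lo k σ) ≡ suc k * count (λ σ → H σ ∧ descendingBlock lo (suc k) σ)
  count-descendingBlock-suc {n} {r} {H} lo k lo+k<n H-inv = begin
    ∑[ σ ∈ S n r ] 𝟙 (H σ ∧ descendingBlock lo k σ)
      ≡⟨ ∑-cong-∈ (S n r) (insertions _ ∘ ∈S⇒Unique) ⟩
    ∑[ σ ∈ S n r ] ∑[ j ∈ upTo (suc k) ] 𝟙 (HD (move j σ))
      ≡⟨ ∑-comm (S n r) (upTo (suc k)) (λ σ j → 𝟙 (HD (move j σ))) ⟩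
    ∑[ j ∈ upTo (suc k) ] ∑[ σ ∈ S n r ] 𝟙 (HD (move j σ))
      ≡⟨ ∑-cong (upTo (suc k)) (λ j → ∑-S-moveDown n r (lo + j) (k ∸ j) (𝟙 ∘ HD)) ⟩
    ∑[ j ∈ upTo (suc k) ] count HD                                ≡⟨ ∑-const (upTo (suc k)) (count HD) ⟩
    length (upTo (suc k)) * count HD                              ≡⟨ cong (_* count HD) (length-upTo (suc k)) ⟩
    suc k * count HD                                              ∎
    where
    open ≡-Reasoning
    HD : ColPerm n r → Bool
    HD σ = H σ ∧ descendingBlock lo (suc k) σ
    move : ℕ → ColPerm n r → ColPerm n r
    move j = moveDownᶜ (lo + j) (k ∸ j)
    move-invariant : ∀ σ {j} → j < suc k → H (move j σ) ≡ H σ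
    move-invariant σ {j} (s≤s j≤k) = moveDown-invariant H-inv (k ∸ j) σ (m≤m+n lo j)
      (subst (_< lo + suc k) (sym (trans (+-assoc lo j (k ∸ j)) (cong (lo +_) (m+[n∸m]≡n j≤k)))) (+-monoʳ-< lo (n<1+n k)))
    insertions : ∀ σ → Unique (toList (proj₁ σ)) →
      𝟙 (H σ ∧ descendingBlock lo k σ) ≡ ∑[ j ∈ upTo (suc k) ] 𝟙 (HD (move j σ))
    insertions σ ω-unique = begin
      𝟙 (H σ ∧ descendingBlock lo k σ)                                        ≡⟨ 𝟙-∧ (H σ) _ ⟩
      𝟙 (H σ) * 𝟙 (descendingBlock lo k σ)
        ≡⟨ cong (𝟙 (H σ) *_) (descendingBlock-moveDown lo k σ ω-unique lo+k<n) ⟨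
      𝟙 (H σ) * ∑[ j ∈ upTo (suc k) ] 𝟙 (descendingBlock lo (suc k) (move j σ))
        ≡⟨ ∑-*ˡ (upTo (suc k)) (𝟙 (H σ)) _ ⟨
      ∑[ j ∈ upTo (suc k) ] (𝟙 (H σ) * 𝟙 (descendingBlock lo (suc k) (move j σ)))
        ≡⟨ ∑-upTo-cong (suc k) (λ {j} j<sk → trans (sym (𝟙-∧ (H σ) (descendingBlock lo (suc k) (move j σ))))
                                                 (cong (λ b → 𝟙 (b ∧ descendingBlock lo (suc k) (move j σ))) (sym (move-invariant σ j<sk)))) ⟩
      ∑[ j ∈ upTo (suc k) ] 𝟙 (HD (move j σ))                                 ∎

  count-descendingBlock : ∀ {H : ColPerm n r → Bool} lo len → lo + len ≤ n → SwapInvariantOn H lo (lo + len) →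
    count (λ σ → H σ ∧ descendingBlock lo len σ) * len ! ≡ count H
  count-descendingBlock             {H = H} lo zero    _        _     =
    trans (*-identityʳ _) (count-cong (λ σ → ∧-identityʳ (H σ)))
  count-descendingBlock {n} {r} {H} lo (suc k) lo+sk≤n H-inv = begin
    count (HD (suc k)) * (suc k * k !)  ≡⟨ *-assoc (count (HD (suc k))) (suc k) (k !) ⟨
    count (HD (suc k)) * suc k * k !    ≡⟨ cong (_* k !) (*-comm (count (HD (suc k))) (suc k)) ⟩
    suc k * count (HD (suc k)) * k !    ≡⟨ cong (_* k !) (count-descendingBlock-suc lo k lo+k<n H-inv) ⟨
    count (HD k) * k !
      ≡⟨ count-descendingBlock lo k (<⇒≤ lo+k<n) (λ σ lo≤i i<lo+k → H-inv σ lo≤i (<-trans i<lo+k lo+k<lo+sk)) ⟩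
    count H                             ∎
    where
    open ≡-Reasoning
    HD : ℕ → ColPerm n r → Bool
    HD len σ = H σ ∧ descendingBlock lo len σ
    lo+k<lo+sk : lo + k < lo + suc k
    lo+k<lo+sk = +-monoʳ-< lo (n<1+n k)
    lo+k<n : lo + k < n
    lo+k<n = <-≤-trans lo+k<lo+sk lo+sk≤n

  drop-swapAt-≥ : ∀ lo j (xs : List A) → drop lo (swapAt (lo + j) xs) ≡ swapAt j (drop lo xs)
  drop-swapAt-≥ zero     j       xs       = refl
  drop-swapAt-≥ (suc lo) zero    []       = refl
  drop-swapAt-≥ (suc lo) (suc j) []       = refl
  drop-swapAt-≥ (suc lo) j       (x ∷ xs) = drop-swapAt-≥ lo j xs

  drop-swapAt-< : ∀ lo i (xs : List A) → suc i < lo → drop lo (swapAt i xs) ≡ drop lo xs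
  drop-swapAt-< (suc zero)     zero    xs           (s≤s ())
  drop-swapAt-< (suc (suc lo)) zero    []           _       = refl
  drop-swapAt-< (suc (suc lo)) zero    (x ∷ [])     _       = refl
  drop-swapAt-< (suc (suc lo)) zero    (x ∷ y ∷ xs) _       = refl
  drop-swapAt-< (suc lo)       (suc i) []           _       = refl
  drop-swapAt-< (suc lo)       (suc i) (x ∷ xs)     (s≤s h) = drop-swapAt-< lo i xs h

  take-swapAt-≥ : ∀ k i (xs : List A) → k ≤ i → take k (swapAt i xs) ≡ take k xs
  take-swapAt-≥ zero    i       xs       _       = refl
  take-swapAt-≥ (suc k) (suc i) []       _       = refl
  take-swapAt-≥ (suc k) (suc i) (x ∷ xs) (s≤s h) = cong (x ∷_) (take-swapAt-≥ k i xs h)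

  block-swapAt-outside : ∀ lo len i (xs : List A) → suc i < lo ⊎ lo + len ≤ i → block lo len (swapAt i xs) ≡ block lo len xs
  block-swapAt-outside lo len i xs (inj₁ i<lo)     = cong (take len) (drop-swapAt-< lo i xs i<lo)
  block-swapAt-outside lo len i xs (inj₂ lo+len≤i) = begin
    take len (drop lo (swapAt i xs))              ≡⟨ cong (λ j → take len (drop lo (swapAt j xs))) (m+[n∸m]≡n lo≤i) ⟨
    take len (drop lo (swapAt (lo + (i ∸ lo)) xs)) ≡⟨ cong (take len) (drop-swapAt-≥ lo (i ∸ lo) xs) ⟩
    take len (swapAt (i ∸ lo) (drop lo xs))       ≡⟨ take-swapAt-≥ len (i ∸ lo) (drop lo xs) len≤i∸lo ⟩
    take len (drop lo xs)                         ∎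
    where
    open ≡-Reasoning
    lo≤i : lo ≤ i
    lo≤i = ≤-trans (m≤m+n lo len) lo+len≤i
    len≤i∸lo : len ≤ i ∸ lo
    len≤i∸lo = subst (_≤ i ∸ lo) (m+n∸m≡n lo len) (∸-monoˡ-≤ lo lo+len≤i)

  descendingBlock-swapAt-outside : ∀ lo len i (σ : ColPerm n r) → suc i < lo ⊎ lo + len ≤ i →
    descendingBlock lo len (swapAtᶜ i σ) ≡ descendingBlock lo len σ
  descendingBlock-swapAt-outside lo len i σ i-outside =
    cong descending (trans (cong (block lo len) (symbols-swapAt i σ)) (block-swapAt-outside lo len i (symbols σ) i-outside))

  record Interval : Set where
    constructor interval
    field
      lo len : ℕ

    end : ℕ
    end = lo + len

  open Interval public

  Apart : Interval → Interval → Set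
  Apart I J = end J ≤ lo I ⊎ end I ≤ lo J

  descendingBlocks : List Interval → ColPerm n r → Bool
  descendingBlocks Is σ = all (λ I → descendingBlock (lo I) (len I) σ) Is

  descendingBlocks-invariant : ∀ I Is → All (Apart I) Is → SwapInvariantOn {n} {r} (descendingBlocks Is) (lo I) (end I)
  descendingBlocks-invariant I []       []                σ lo≤i i<end = refl
  descendingBlocks-invariant I (J ∷ Is) (I⋈J ∷ I⋈Is) {i} σ lo≤i i<end =
    cong₂ _∧_ (descendingBlock-swapAt-outside (lo J) (len J) i σ (swap-outside I⋈J))
              (descendingBlocks-invariant I Is I⋈Is σ lo≤i i<end)
    where
    swap-outside : Apart I J → suc i < lo J ⊎ lo J + len J ≤ i
    swap-outside (inj₁ J≤I) = inj₂ (≤-trans J≤I lo≤i)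
    swap-outside (inj₂ I≤J) = inj₁ (<-≤-trans i<end I≤J)

  factorials : List Interval → ℕ
  factorials Is = product (map (λ I → len I !) Is)

  count-descendingBlocks : ∀ {H : ColPerm n r → Bool} Is → AllPairs Apart Is → All (λ I → end I ≤ n) Is →
    All (λ I → SwapInvariantOn H (lo I) (end I)) Is →
    count (λ σ → H σ ∧ descendingBlocks Is σ) * factorials Is ≡ count H
  count-descendingBlocks {H = H} [] [] [] [] = trans (*-identityʳ _) (count-cong (λ σ → ∧-identityʳ (H σ)))
  count-descendingBlocks {n} {r} {H} (I ∷ Is) (I⋈Is ∷ apart) (I≤n ∷ Is≤n) (H-inv ∷ Hs-inv) = begin
    count (λ σ → H σ ∧ (D σ ∧ Ds σ)) * (len I ! * factorials Is)
      ≡⟨ cong₂ _*_ (count-cong (λ σ → reassoc (H σ) (D σ) (Ds σ))) refl ⟩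
    count (λ σ → (H σ ∧ Ds σ) ∧ D σ) * (len I ! * factorials Is)
      ≡⟨ *-assoc (count (λ σ → (H σ ∧ Ds σ) ∧ D σ)) (len I !) (factorials Is) ⟨
    count (λ σ → (H σ ∧ Ds σ) ∧ D σ) * len I ! * factorials Is
      ≡⟨ cong (_* factorials Is) (count-descendingBlock (lo I) (len I) I≤n
           (SwapInvariantOn-∧ H-inv (descendingBlocks-invariant I Is I⋈Is))) ⟩
    count (λ σ → H σ ∧ Ds σ) * factorials Is
      ≡⟨ count-descendingBlocks Is apart Is≤n Hs-inv ⟩
    count H ∎
    where
    open ≡-Reasoning
    D Ds : ColPerm n r → Bool
    D = descendingBlock (lo I) (len I)
    Ds = descendingBlocks Is
    reassoc : ∀ a b c → a ∧ (b ∧ c) ≡ (a ∧ c) ∧ b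
    reassoc a b c = trans (cong (a ∧_) (∧-comm b c)) (sym (∧-assoc a c b))

  -- Nonzero colours

  all-swapAt : (f : A → Bool) → ∀ i xs → all f (swapAt i xs) ≡ all f xs
  all-swapAt f zero    []           = refl
  all-swapAt f zero    (x ∷ [])     = refl
  all-swapAt f zero    (x ∷ y ∷ xs) =
    trans (sym (∧-assoc (f y) (f x) _)) (trans (cong (_∧ all f xs) (∧-comm (f y) (f x))) (∧-assoc (f x) (f y) _))
  all-swapAt f (suc i) []           = refl
  all-swapAt f (suc i) (x ∷ xs)     = cong (f x ∧_) (all-swapAt f i xs)

  all-drop-swapAt : (f : A → Bool) → ∀ m i xs → suc i < m ⊎ m ≤ i → all f (drop m (swapAt i xs)) ≡ all f (drop m xs)
  all-drop-swapAt f m i xs (inj₁ i<m) = cong (all f) (drop-swapAt-< m i xs i<m)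
  all-drop-swapAt f m i xs (inj₂ m≤i) = begin
    all f (drop m (swapAt i xs))              ≡⟨ cong (λ j → all f (drop m (swapAt j xs))) (m+[n∸m]≡n m≤i) ⟨
    all f (drop m (swapAt (m + (i ∸ m)) xs))  ≡⟨ cong (all f) (drop-swapAt-≥ m (i ∸ m) xs) ⟩
    all f (swapAt (i ∸ m) (drop m xs))        ≡⟨ all-swapAt f (i ∸ m) (drop m xs) ⟩
    all f (drop m xs)                         ∎
    where open ≡-Reasoning

  positiveColour : ℕ × ℕ → Bool
  positiveColour s = 0 <ᵇ proj₂ s

  positiveColoursFrom : ℕ → ColPerm n r → Bool
  positiveColoursFrom m σ = all positiveColour (drop m (symbols σ))

  positiveColoursFrom-invariant : ∀ m I → m ≤ lo I ⊎ end I ≤ m → SwapInvariantOn {n} {r} (positiveColoursFrom m) (lo I) (end I)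
  positiveColoursFrom-invariant m I apart {i} σ lo≤i i<end = trans
    (cong (all positiveColour ∘ drop m) (symbols-swapAt i σ))
    (all-drop-swapAt positiveColour m i (symbols σ) (swap-outside apart))
    where
    swap-outside : m ≤ lo I ⊎ end I ≤ m → suc i < m ⊎ m ≤ i
    swap-outside (inj₁ m≤lo)  = inj₂ (≤-trans m≤lo lo≤i)
    swap-outside (inj₂ end≤m) = inj₁ (<-≤-trans i<end end≤m)

  all-lookupOr⁻ : (f : A → Bool) → ∀ xs d → T (all f xs) → ∀ {i} → i < length xs → T (f (lookupOr xs i d))
  all-lookupOr⁻ f (x ∷ xs) d t {zero}  _       = proj₁ (Equivalence.to T-∧ t)
  all-lookupOr⁻ f (x ∷ xs) d t {suc i} (s≤s h) = all-lookupOr⁻ f xs d (proj₂ (Equivalence.to T-∧ t)) h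

  all-lookupOr⁺ : (f : A → Bool) → ∀ xs d → (∀ {i} → i < length xs → T (f (lookupOr xs i d))) → T (all f xs)
  all-lookupOr⁺ f []       d h = _
  all-lookupOr⁺ f (x ∷ xs) d h = Equivalence.from T-∧ (h (s≤s z≤n) , all-lookupOr⁺ f xs d (h ∘ s≤s))

  length-drop-symbols : ∀ m (σ : ColPerm n r) → length (drop m (symbols σ)) ≡ n ∸ m
  length-drop-symbols m σ = trans (length-drop m (symbols σ)) (cong (_∸ m) (length-symbols σ))

  positiveColoursFrom⁻ : ∀ m (σ : ColPerm n r) → T (positiveColoursFrom m σ) →
    ∀ {p} → m ≤ p → p < n → 0 < proj₂ (symbolAt σ p)
  positiveColoursFrom⁻ {n} m σ t {p} m≤p p<n = <ᵇ⇒< 0 _ (subst (T ∘ positiveColour) symbol-p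
    (all-lookupOr⁻ positiveColour (drop m (symbols σ)) (suc n , 0) t
      (subst (p ∸ m <_) (sym (length-drop-symbols m σ)) (∸-monoˡ-< p<n m≤p))))
    where
    symbol-p : lookupOr (drop m (symbols σ)) (p ∸ m) (suc n , 0) ≡ symbolAt σ p
    symbol-p = trans (lookupOr-drop m (symbols σ) (p ∸ m) _)
      (trans (cong (λ q → lookupOr (symbols σ) q (suc n , 0)) (m+[n∸m]≡n m≤p)) (sym (symbolAt≡lookupOr σ p)))

  positiveColoursFrom⁺ : ∀ m (σ : ColPerm n r) → m ≤ n → (∀ {p} → m ≤ p → p < n → 0 < proj₂ (symbolAt σ p)) →
    T (positiveColoursFrom m σ)
  positiveColoursFrom⁺ {n} m σ m≤n h = all-lookupOr⁺ positiveColour (drop m (symbols σ)) (suc n , 0) λ {i} i<len →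
    subst (T ∘ positiveColour)
    (trans (symbolAt≡lookupOr σ (m + i)) (sym (lookupOr-drop m (symbols σ) i _)))
    (<⇒<ᵇ (h (m≤m+n m i) (subst (m + i <_) (m+[n∸m]≡n m≤n) (+-monoʳ-< m (subst (i <_) (length-drop-symbols m σ) i<len)))))

  all-drop-symbols : ∀ {k} m (ω : Vec (Fin n) k) (τ : Vec (Fin r) k) →
    all positiveColour (drop m (toList (Vec.zipWith symbol ω τ))) ≡ all (λ c → 0 <ᵇ toℕ c) (drop m (toList τ))
  all-drop-symbols zero    []       []       = refl
  all-drop-symbols zero    (x ∷ ω)  (c ∷ τ)  = cong ((0 <ᵇ toℕ c) ∧_) (all-drop-symbols zero ω τ)
  all-drop-symbols (suc m) []       []       = refl
  all-drop-symbols (suc m) (x ∷ ω)  (c ∷ τ)  = all-drop-symbols m ω τ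

  ∑-allVecs-all-drop : ∀ n m k (f : Fin k → Bool) → m ≤ n →
    ∑[ v ∈ allVecs n k ] 𝟙 (all f (drop m (toList v))) ≡ k ^ m * (∑[ x ∈ allFin k ] 𝟙 (f x)) ^ (n ∸ m)
  ∑-allVecs-all-drop zero    zero    k f _ = refl
  ∑-allVecs-all-drop (suc n) zero    k f _ = begin
    ∑[ v ∈ allVecs (suc n) k ] 𝟙 (all f (toList v))                     ≡⟨ ∑-allVecs-suc n k _ ⟩
    ∑[ v ∈ allVecs n k ] ∑[ x ∈ allFin k ] 𝟙 (f x ∧ all f (toList v))
      ≡⟨ ∑-cong (allVecs n k) (λ v → trans (∑-cong (allFin k) (λ x → trans (𝟙-∧ (f x) _) (*-comm (𝟙 (f x)) _)))
                                           (∑-*ˡ (allFin k) (𝟙 (all f (toList v))) (𝟙 ∘ f))) ⟩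
    ∑[ v ∈ allVecs n k ] (𝟙 (all f (toList v)) * c)                      ≡⟨ ∑-cong (allVecs n k) (λ v → *-comm _ c) ⟩
    ∑[ v ∈ allVecs n k ] (c * 𝟙 (all f (toList v)))                      ≡⟨ ∑-*ˡ (allVecs n k) c _ ⟩
    c * ∑[ v ∈ allVecs n k ] 𝟙 (all f (toList v))                        ≡⟨ cong (c *_) (∑-allVecs-all-drop n zero k f z≤n) ⟩
    c * (1 * c ^ n)                                                       ≡⟨ cong (c *_) (*-identityˡ (c ^ n)) ⟩
    c * c ^ n                                                             ≡⟨ *-identityˡ (c * c ^ n) ⟨
    1 * (c * c ^ n)                                                       ∎
    where
    open ≡-Reasoning
    c : ℕ
    c = ∑[ x ∈ allFin k ] 𝟙 (f x)
  ∑-allVecs-all-drop (suc n) (suc m) k f (s≤s m≤n) = begin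
    ∑[ v ∈ allVecs (suc n) k ] 𝟙 (all f (drop (suc m) (toList v)))        ≡⟨ ∑-allVecs-suc n k _ ⟩
    ∑[ v ∈ allVecs n k ] ∑[ x ∈ allFin k ] 𝟙 (all f (drop m (toList v)))
      ≡⟨ ∑-cong (allVecs n k) (λ v → trans (∑-const (allFin k) (𝟙 (all f (drop m (toList v)))))
                                           (cong (_* 𝟙 (all f (drop m (toList v)))) (length-tabulate {n = k} id))) ⟩
    ∑[ v ∈ allVecs n k ] (k * 𝟙 (all f (drop m (toList v))))              ≡⟨ ∑-*ˡ (allVecs n k) k _ ⟩
    k * ∑[ v ∈ allVecs n k ] 𝟙 (all f (drop m (toList v)))                ≡⟨ cong (k *_) (∑-allVecs-all-drop n m k f m≤n) ⟩
    k * (k ^ m * c ^ (n ∸ m))                                             ≡⟨ *-assoc k (k ^ m) _ ⟨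
    k * k ^ m * c ^ (n ∸ m)                                               ∎
    where
    open ≡-Reasoning
    c : ℕ
    c = ∑[ x ∈ allFin k ] 𝟙 (f x)

  ∑-allFin-positive : ∀ r → ∑[ c ∈ allFin r ] 𝟙 (0 <ᵇ toℕ c) ≡ r ∸ 1
  ∑-allFin-positive zero    = refl
  ∑-allFin-positive (suc r) = begin
    ∑ (tabulate {n = r} Fin.suc) (λ c → 𝟙 (0 <ᵇ toℕ c))
      ≡⟨ cong (λ cs → ∑ cs (λ c → 𝟙 (0 <ᵇ toℕ c))) (map-tabulate {n = r} id Fin.suc) ⟨
    ∑ (map Fin.suc (allFin r)) (λ c → 𝟙 (0 <ᵇ toℕ c))   ≡⟨ ∑-map Fin.suc (allFin r) _ ⟩
    ∑[ _ ∈ allFin r ] 1                                   ≡⟨ ∑-const (allFin r) 1 ⟩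
    length (allFin r) * 1                                 ≡⟨ *-identityʳ _ ⟩
    length (allFin r)                                     ≡⟨ length-tabulate {n = r} id ⟩
    r                                                     ∎
    where open ≡-Reasoning

  count-positiveColoursFrom : ∀ n r m → m ≤ n →
    count (positiveColoursFrom {n} {r} m) ≡ length (Perms n) * (r ^ m * (r ∸ 1) ^ (n ∸ m))
  count-positiveColoursFrom n r m m≤n = begin
    ∑[ σ ∈ S n r ] 𝟙 (positiveColoursFrom m σ)
      ≡⟨ ∑-cong (S n r) (λ (ω , τ) → cong 𝟙 (all-drop-symbols m ω τ)) ⟩
    ∑[ σ ∈ S n r ] 𝟙 (all (λ c → 0 <ᵇ toℕ c) (drop m (toList (proj₂ σ))))
      ≡⟨ ∑-S-colouring n r _ ⟩
    length (Perms n) * ∑[ τ ∈ allVecs n r ] 𝟙 (all (λ c → 0 <ᵇ toℕ c) (drop m (toList τ)))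
      ≡⟨ cong (length (Perms n) *_) (∑-allVecs-all-drop n m r _ m≤n) ⟩
    length (Perms n) * (r ^ m * (∑[ c ∈ allFin r ] 𝟙 (0 <ᵇ toℕ c)) ^ (n ∸ m))
      ≡⟨ cong (λ c → length (Perms n) * (r ^ m * c ^ (n ∸ m))) (∑-allFin-positive r) ⟩
    length (Perms n) * (r ^ m * (r ∸ 1) ^ (n ∸ m)) ∎
    where open ≡-Reasoning

  -- The blocks are intervals

  ⟦_⟧ : Interval → Subset n
  ⟦_⟧ {zero}  _                        = []
  ⟦_⟧ {suc n} (interval (suc lo) len)  = outside ∷ ⟦ interval lo len ⟧
  ⟦_⟧ {suc n} (interval zero zero)     = outside ∷ ⟦ interval zero zero ⟧
  ⟦_⟧ {suc n} (interval zero (suc len)) = inside ∷ ⟦ interval zero len ⟧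

  ∈⟦⟧⁻ : ∀ I (p : Fin n) → p ∈ ⟦ I ⟧ → lo I ≤ toℕ p × toℕ p < end I
  ∈⟦⟧⁻ (interval (suc lo) len)   (Fin.suc p) (there p∈) = Product.map s≤s s≤s (∈⟦⟧⁻ (interval lo len) p p∈)
  ∈⟦⟧⁻ (interval zero zero)      (Fin.suc p) (there p∈) = contradiction (proj₂ (∈⟦⟧⁻ (interval 0 0) p p∈)) λ ()
  ∈⟦⟧⁻ (interval zero (suc len)) Fin.zero    here       = z≤n , s≤s z≤n
  ∈⟦⟧⁻ (interval zero (suc len)) (Fin.suc p) (there p∈) = z≤n , s≤s (proj₂ (∈⟦⟧⁻ (interval 0 len) p p∈))

  ∈⟦⟧⁺ : ∀ I (p : Fin n) → lo I ≤ toℕ p → toℕ p < end I → p ∈ ⟦ I ⟧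
  ∈⟦⟧⁺ (interval (suc lo) len)   (Fin.suc p) (s≤s lo≤p) (s≤s p<end) = there (∈⟦⟧⁺ (interval lo len) p lo≤p p<end)
  ∈⟦⟧⁺ (interval zero (suc len)) Fin.zero    _          _           = here
  ∈⟦⟧⁺ (interval zero (suc len)) (Fin.suc p) _          (s≤s p<end) = there (∈⟦⟧⁺ (interval 0 len) p z≤n p<end)

  fromℕ<∈⟦⟧ : ∀ I {p} (p<n : p < n) → lo I ≤ p → p < end I → fromℕ< p<n ∈ ⟦ I ⟧
  fromℕ<∈⟦⟧ I p<n lo≤p p<end = ∈⟦⟧⁺ I (fromℕ< p<n) (subst (lo I ≤_) (sym (toℕ-fromℕ< p<n)) lo≤p)
                                                   (subst (_< end I) (sym (toℕ-fromℕ< p<n)) p<end)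

  ∣⟦⟧∣ : ∀ I → end I ≤ n → ∣ ⟦_⟧ {n} I ∣ ≡ len I
  ∣⟦⟧∣ {zero}  (interval zero      zero)      _         = refl
  ∣⟦⟧∣ {suc n} (interval (suc lo)  len)       (s≤s end≤) = ∣⟦⟧∣ (interval lo len) end≤
  ∣⟦⟧∣ {suc n} (interval zero      zero)      _          = ∣⟦⟧∣ {n} (interval 0 0) z≤n
  ∣⟦⟧∣ {suc n} (interval zero      (suc len)) (s≤s end≤) = cong suc (∣⟦⟧∣ (interval 0 len) end≤)

  least : {P : ℕ → Set} → Decidable P → ∀ {x} → P x → ∃ λ l → P l × (∀ {j} → j < l → ¬ P j)
  least {P} P? {x} px = [ id , (λ none → contradiction px (none (n<1+n x))) ] (search (suc x))
    where
    search : ∀ k → (∃ λ l → P l × (∀ {j} → j < l → ¬ P j)) ⊎ (∀ {j} → j < k → ¬ P j)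
    search zero = inj₂ λ ()
    search (suc k) with search k
    ... | inj₁ found = inj₁ found
    ... | inj₂ none with P? k
    ...   | yes pk  = inj₁ (k , pk , none)
    ...   | no  ¬pk = inj₂ λ j<sk → [ none , (λ { refl → ¬pk }) ] (m≤n⇒m<n∨m≡n (s≤s⁻¹ j<sk))

  greatest : {P : ℕ → Set} → Decidable P → ∀ {n} → (∀ {j} → P j → j < n) → ∀ {x} → P x →
    ∃ λ h → P h × (∀ {j} → P j → j ≤ h)
  greatest P? {zero}  bound px = contradiction (bound px) λ ()
  greatest P? {suc n} bound px with P? n
  ... | yes pn  = n , pn , s≤s⁻¹ ∘ bound
  ... | no  ¬pn = greatest P? (λ {j} pj → [ id , (λ { refl → contradiction pj ¬pn }) ] (m≤n⇒m<n∨m≡n (s≤s⁻¹ (bound pj))))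
                    px

  module _ (B : Subset n) where

    private
      InB : ℕ → Set
      InB j = Σ (j < n) λ j<n → fromℕ< j<n ∈ B

      InB? : Decidable InB
      InB? j with j <? n
      ... | no  j≮n = no (j≮n ∘ proj₁)
      ... | yes j<n with fromℕ< j<n ∈? B
      ...   | yes j∈B = yes (j<n , j∈B)
      ...   | no  j∉B = no λ (j<n′ , j∈B) → j∉B (subst (_∈ B) (fromℕ<-cong j j refl j<n′ j<n) j∈B)

      toInB : ∀ {p} → p ∈ B → InB (toℕ p)
      toInB {p} p∈B = toℕ<n p , subst (_∈ B) (sym (fromℕ<-toℕ p (toℕ<n p))) p∈B

    extremes : ∀ {x} → x ∈ B →
      ∃ λ l → ∃ λ h → l ∈ B × h ∈ B × (∀ {p} → p ∈ B → toℕ l ≤ toℕ p × toℕ p ≤ toℕ h)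
    extremes x∈B with least InB? (toInB x∈B) | greatest InB? proj₁ (toInB x∈B)
    ... | l , (l<n , l∈B) , below-l | h , (h<n , h∈B) , above-h = fromℕ< l<n , fromℕ< h<n , l∈B , h∈B , bounds
      where
      bounds : ∀ {p} → p ∈ B → toℕ (fromℕ< l<n) ≤ toℕ p × toℕ p ≤ toℕ (fromℕ< h<n)
      bounds {p} p∈B = subst (_≤ toℕ p) (sym (toℕ-fromℕ< l<n)) (≮⇒≥ λ p<l → below-l p<l (toInB p∈B))
                     , subst (toℕ p ≤_) (sym (toℕ-fromℕ< h<n)) (above-h (toInB p∈B))

  module Orbits (as : List (Fin n)) where

    Between : Fin n → Fin n → Fin n → Set
    Between i j k = (toℕ i ≤ toℕ k × toℕ k < toℕ j) ⊎ (toℕ j ≤ toℕ k × toℕ k < toℕ i)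

    Joined : Fin n → Fin n → Set
    Joined i j = ∀ k → Between i j k → k ∈ₗ as

    Joined-refl : ∀ i → Joined i i
    Joined-refl i k (inj₁ (i≤k , k<i)) = contradiction (≤-<-trans i≤k k<i) (<-irrefl refl)
    Joined-refl i k (inj₂ (i≤k , k<i)) = contradiction (≤-<-trans i≤k k<i) (<-irrefl refl)

    Joined-sym : ∀ {i j} → Joined i j → Joined j i
    Joined-sym i~j k = i~j k ∘ [ inj₂ , inj₁ ]

    Joined-trans : ∀ {i j l} → Joined i j → Joined j l → Joined i l
    Joined-trans {j = j} i~j j~l k (inj₁ (i≤k , k<l)) with toℕ k <? toℕ j
    ... | yes k<j = i~j k (inj₁ (i≤k , k<j))
    ... | no  k≮j = j~l k (inj₁ (≮⇒≥ k≮j , k<l))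
    Joined-trans {j = j} i~j j~l k (inj₂ (l≤k , k<i)) with toℕ k <? toℕ j
    ... | yes k<j = j~l k (inj₂ (l≤k , k<j))
    ... | no  k≮j = i~j k (inj₂ (≮⇒≥ k≮j , k<i))

    SwappedBy⇒Joined : ∀ {i j} → SwappedBy as i j → Joined i j
    SwappedBy⇒Joined (i∈as , j≡1+i) k (inj₁ (i≤k , k<j)) =
      subst (_∈ₗ as) (toℕ-injective (≤-antisym i≤k (s≤s⁻¹ (subst (toℕ k <_) j≡1+i k<j)))) i∈as
    SwappedBy⇒Joined (i∈as , j≡1+i) k (inj₂ (j≤k , k<i)) =
      contradiction (<-trans (subst (_≤ toℕ k) j≡1+i j≤k) k<i) (<-irrefl refl)

    SameOrbit⇒Joined : ∀ {i j} → SameOrbit as i j → Joined i j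
    SameOrbit⇒Joined ε              = Joined-refl _
    SameOrbit⇒Joined (fwd s ◅ rest) = Joined-trans (SwappedBy⇒Joined s) (SameOrbit⇒Joined rest)
    SameOrbit⇒Joined (bwd s ◅ rest) = Joined-trans (Joined-sym (SwappedBy⇒Joined s)) (SameOrbit⇒Joined rest)

    module _ {B : Subset n} (B-block : IsBlock as B) where

      block⇒SameOrbit : ∀ {i j} → i ∈ B → j ∈ B → SameOrbit as i j
      block⇒SameOrbit {i} {j} i∈B = Equivalence.to (proj₂ B-block i j i∈B)

      SameOrbit⇒block : ∀ {i j} → i ∈ B → SameOrbit as i j → j ∈ B
      SameOrbit⇒block {i} {j} i∈B = Equivalence.from (proj₂ B-block i j i∈B)

      successor∈block : ∀ {i j} → i ∈ B → i ∈ₗ as → toℕ j ≡ suc (toℕ i) → j ∈ B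
      successor∈block i∈B i∈as j≡1+i = SameOrbit⇒block i∈B (fwd (i∈as , j≡1+i) ◅ ε)

      block-convex : ∀ {l h} → l ∈ B → h ∈ B → ∀ {p} → toℕ l ≤ toℕ p → toℕ p ≤ toℕ h → p ∈ B
      block-convex {l} {h} l∈B h∈B {p} l≤p p≤h = fill (toℕ p ∸ toℕ l) p (m∸n+n≡m l≤p) p≤h
        where
        fill : ∀ d q → d + toℕ l ≡ toℕ q → toℕ q ≤ toℕ h → q ∈ B
        fill zero    q l≡q _   = subst (_∈ B) (toℕ-injective l≡q) l∈B
        fill (suc d) q q≡ q≤h = successor∈block (fill d q′ (sym (toℕ-fromℕ< q′<n)) (<⇒≤ q′<h)) q′∈as
                                  (trans (sym q≡) (cong suc (sym (toℕ-fromℕ< q′<n))))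
          where
          q′<q : d + toℕ l < toℕ q
          q′<q = subst (d + toℕ l <_) q≡ (n<1+n _)
          q′<n : d + toℕ l < n
          q′<n = <-trans q′<q (toℕ<n q)
          q′ : Fin n
          q′ = fromℕ< q′<n
          q′<h : toℕ q′ < toℕ h
          q′<h = subst (_< toℕ h) (sym (toℕ-fromℕ< q′<n)) (<-≤-trans q′<q q≤h)
          q′∈as : q′ ∈ₗ as
          q′∈as = SameOrbit⇒Joined (block⇒SameOrbit l∈B h∈B) q′
                    (inj₁ (subst (toℕ l ≤_) (sym (toℕ-fromℕ< q′<n)) (m≤n+m (toℕ l) d) , q′<h))

      block⇒interval : ∃ λ I → B ≡ ⟦ I ⟧ × 0 < len I × end I ≤ n
      block⇒interval with extremes B (proj₂ (proj₁ B-block))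
      ... | l , h , l∈B , h∈B , bounds = I , ⊆-antisym B⊆I I⊆B , 0<len , end≤n
        where
        l≤h : toℕ l ≤ toℕ h
        l≤h = proj₁ (bounds h∈B)
        I : Interval
        I = interval (toℕ l) (suc (toℕ h) ∸ toℕ l)
        end≡ : end I ≡ suc (toℕ h)
        end≡ = m+[n∸m]≡n (≤-trans l≤h (n≤1+n _))
        0<len : 0 < len I
        0<len = m<n⇒0<n∸m (s≤s l≤h)
        end≤n : end I ≤ n
        end≤n = subst (_≤ n) (sym end≡) (toℕ<n h)
        B⊆I : ∀ {p} → p ∈ B → p ∈ ⟦ I ⟧
        B⊆I {p} p∈B = ∈⟦⟧⁺ I p (proj₁ (bounds p∈B)) (subst (toℕ p <_) (sym end≡) (s≤s (proj₂ (bounds p∈B))))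
        I⊆B : ∀ {p} → p ∈ ⟦ I ⟧ → p ∈ B
        I⊆B {p} p∈I with ∈⟦⟧⁻ I p p∈I
        ... | l≤p , p<end = block-convex l∈B h∈B l≤p (s≤s⁻¹ (subst (toℕ p <_) end≡ p<end))

    blocks-≡ : ∀ {B B′ x} → IsBlock as B → IsBlock as B′ → x ∈ B → x ∈ B′ → B ≡ B′
    blocks-≡ B-block B′-block x∈B x∈B′ = ⊆-antisym
      (λ p∈B → SameOrbit⇒block B′-block x∈B′ (block⇒SameOrbit B-block x∈B p∈B))
      (λ p∈B′ → SameOrbit⇒block B-block x∈B (block⇒SameOrbit B′-block x∈B′ p∈B′))

  -- Positions are 0-based: p ∈ ps stands for the paper's a = p + 1, and an interval I for
  -- the block {lo I + 1, …, end I}.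
  record InducedBlocks (n : ℕ) (ps : List ℕ) (Is : List Interval) : Set where
    field
      below   : All (_< n) ps
      bounded : All (λ I → end I ≤ n) Is
      apart   : AllPairs Apart Is
      joined  : ∀ {I} → I ∈ₗ Is → ∀ {p} → lo I ≤ p → suc p < end I → p ∈ₗ ps
      cut     : ∀ {p} → p ∈ₗ ps → suc p < n → ∃ λ I → I ∈ₗ Is × lo I ≤ p × suc p < end I

  module _ (as : List (Fin n)) where

    open Orbits as

    BlockInterval : Interval → Set
    BlockInterval I = IsBlock as ⟦ I ⟧ × 0 < len I × end I ≤ n

    blocks⇒intervals : ∀ {Bs} → All (IsBlock as) Bs → ∃ λ Is → Bs ≡ map ⟦_⟧ Is × All BlockInterval Is
    blocks⇒intervals []                = [] , refl , []
    blocks⇒intervals (B-block ∷ blocks) with block⇒interval B-block | blocks⇒intervals blocks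
    ... | I , refl , 0<len , end≤n | Is , refl , Is-blocks = I ∷ Is , refl , (B-block , 0<len , end≤n) ∷ Is-blocks

    distinct⇒Apart : ∀ {I J} → BlockInterval I → BlockInterval J → ⟦ I ⟧ ≢ ⟦ J ⟧ → Apart I J
    distinct⇒Apart {I} {J} (I-block , 0<I , I≤n) (J-block , 0<J , J≤n) I≢J with end J ≤? lo I | end I ≤? lo J
    ... | yes J≤I | _       = inj₁ J≤I
    ... | no  _   | yes I≤J = inj₂ I≤J
    ... | no  J≰I | no  I≰J =
      contradiction (blocks-≡ I-block J-block (common I lo-I≤ ⊔<end-I) (common J lo-J≤ ⊔<end-J)) I≢J
      where
      lo-I≤ : lo I ≤ lo I ⊔ lo J
      lo-I≤ = m≤m⊔n (lo I) (lo J)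
      lo-J≤ : lo J ≤ lo I ⊔ lo J
      lo-J≤ = m≤n⊔m (lo I) (lo J)
      ⊔<end-I : lo I ⊔ lo J < end I
      ⊔<end-I = ⊔-lub (m<m+n (lo I) 0<I) (≰⇒> I≰J)
      ⊔<end-J : lo I ⊔ lo J < end J
      ⊔<end-J = ⊔-lub (≰⇒> J≰I) (m<m+n (lo J) 0<J)
      ⊔<n : lo I ⊔ lo J < n
      ⊔<n = <-≤-trans ⊔<end-I I≤n
      common : ∀ K → lo K ≤ lo I ⊔ lo J → lo I ⊔ lo J < end K → fromℕ< ⊔<n ∈ ⟦ K ⟧
      common K lo-K≤ ⊔<end-K = ∈⟦⟧⁺ K (fromℕ< ⊔<n) (subst (lo K ≤_) (sym (toℕ-fromℕ< ⊔<n)) lo-K≤)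
                                                   (subst (_< end K) (sym (toℕ-fromℕ< ⊔<n)) ⊔<end-K)

    intervals-apart : ∀ {Is} → All BlockInterval Is → Unique (map (⟦_⟧ {n}) Is) → AllPairs Apart Is
    intervals-apart {[]}     []                []       = []
    intervals-apart {I ∷ Is} (I-ok ∷ Is-ok) (I∉ ∷ u) = apart-from-I Is-ok I∉ ∷ intervals-apart Is-ok u
      where
      apart-from-I : ∀ {Js} → All BlockInterval Js → All (⟦ I ⟧ ≢_) (map (⟦_⟧ {n}) Js) → All (Apart I) Js
      apart-from-I {[]}     []             []           = []
      apart-from-I {J ∷ Js} (J-ok ∷ Js-ok) (I≢J ∷ I≢Js) = distinct⇒Apart I-ok J-ok I≢J ∷ apart-from-I Js-ok I≢Js

    intervals-joined : ∀ {Is I} → All BlockInterval Is → I ∈ₗ Is →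
      ∀ {p} → lo I ≤ p → suc p < end I → p ∈ₗ map toℕ as
    intervals-joined Is-ok I∈Is {p} lo≤p 1+p<end with All.lookup Is-ok I∈Is
    ... | I-block , _ , end≤n = subst (_∈ₗ map toℕ as) (toℕ-fromℕ< p<n) (∈-map⁺ toℕ p∈as)
      where
      1+p<n : suc p < n
      1+p<n = <-≤-trans 1+p<end end≤n
      p<n : p < n
      p<n = <-trans (n<1+n p) 1+p<n
      p∈as : fromℕ< p<n ∈ₗ as
      p∈as = SameOrbit⇒Joined
        (block⇒SameOrbit I-block (fromℕ<∈⟦⟧ _ p<n lo≤p (<-trans (n<1+n p) 1+p<end))
                                 (fromℕ<∈⟦⟧ _ 1+p<n (≤-trans lo≤p (n≤1+n p)) 1+p<end))
        (fromℕ< p<n) (inj₁ (≤-refl , subst₂ _<_ (sym (toℕ-fromℕ< p<n)) (sym (toℕ-fromℕ< 1+p<n)) (n<1+n p)))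

    intervals-cut : ∀ {Is} → All BlockInterval Is → (∀ i → ∃ λ B → B ∈ₗ map ⟦_⟧ Is × i ∈ B) →
      ∀ {p} → p ∈ₗ map toℕ as → suc p < n → ∃ λ I → I ∈ₗ Is × lo I ≤ p × suc p < end I
    intervals-cut Is-ok cover p∈ 1+p<n with ∈-map⁻ toℕ p∈
    ... | a , a∈as , refl with cover a
    ...   | B , B∈ , a∈B with ∈-map⁻ ⟦_⟧ B∈
    ...     | I , I∈Is , refl =
      I , I∈Is , proj₁ (∈⟦⟧⁻ I a a∈B) , subst (_< end I) (toℕ-fromℕ< 1+p<n) (proj₂ (∈⟦⟧⁻ I a′ a′∈I))
      where
      a′ : Fin _
      a′ = fromℕ< 1+p<n
      a′∈I : a′ ∈ ⟦ I ⟧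
      a′∈I = successor∈block (proj₁ (All.lookup Is-ok I∈Is)) a∈B a∈as (toℕ-fromℕ< 1+p<n)

    blockList⇒intervals : ∀ {Bs} → IsBlockList as Bs →
      ∃ λ Is → Bs ≡ map ⟦_⟧ Is × All BlockInterval Is × InducedBlocks n (map toℕ as) Is
    blockList⇒intervals (blocks , unique , cover) with blocks⇒intervals blocks
    ... | Is , refl , Is-ok = Is , refl , Is-ok , record
      { below   = All.tabulate λ p∈ → case ∈-map⁻ toℕ p∈ of λ { (a , _ , refl) → toℕ<n a }
      ; bounded = All.map (proj₂ ∘ proj₂) Is-ok
      ; apart   = intervals-apart Is-ok unique
      ; joined  = intervals-joined Is-ok
      ; cut     = intervals-cut Is-ok cover
      }

    top-interval : ∀ {Is Bt t} → All BlockInterval Is → Bt ∈ₗ map ⟦_⟧ Is → IsTop t → t ∈ Bt →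
      ∃ λ It → It ∈ₗ Is × Bt ≡ ⟦ It ⟧ × end It ≡ n
    top-interval Is-ok Bt∈ t-top t∈Bt with ∈-map⁻ ⟦_⟧ Bt∈
    ... | It , It∈Is , refl = It , It∈Is , refl ,
      ≤-antisym (proj₂ (proj₂ (All.lookup Is-ok It∈Is))) (subst (_≤ end It) t-top (proj₂ (∈⟦⟧⁻ It _ t∈Bt)))

  -- Descents at the a_i

  ≺⇒colour≤ : ∀ {x y} → x ≺ y → proj₂ x ≤ proj₂ y
  ≺⇒colour≤ (inj₁ c<d)      = <⇒≤ c<d
  ≺⇒colour≤ (inj₂ (refl , _)) = ≤-refl

  allDescents : List ℕ → ColPerm n r → Bool
  allDescents ps σ = all (λ p → does (symbolAt σ (suc p) ≺? symbolAt σ p)) ps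

  prodX≡𝟙-allDescents : ∀ (as : List (Fin n)) (σ : ColPerm n r) → prodX as σ ≡ 𝟙 (allDescents (map toℕ as) σ)
  prodX≡𝟙-allDescents []       σ = refl
  prodX≡𝟙-allDescents (a ∷ as) σ = trans (cong (X a σ *_) (prodX≡𝟙-allDescents as σ))
    (sym (𝟙-∧ (does (symbolAt σ (suc (toℕ a)) ≺? symbolAt σ (toℕ a))) (allDescents (map toℕ as) σ)))

  allDescents⁻ : ∀ {ps} {σ : ColPerm n r} → T (allDescents ps σ) → ∀ {p} → p ∈ₗ ps → Descent σ p
  allDescents⁻ {ps = ps} {σ} t {p} p∈ps = does⇒ (symbolAt σ (suc p) ≺? symbolAt σ p) (All.lookup (all⁺ _ ps t) p∈ps)

  allDescents⁺ : ∀ {ps} {σ : ColPerm n r} → (∀ {p} → p ∈ₗ ps → Descent σ p) → T (allDescents ps σ)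
  allDescents⁺ {σ = σ} descents =
    all⁻ _ (All.tabulate λ {p} p∈ps → ⇒does (symbolAt σ (suc p) ≺? symbolAt σ p) (descents p∈ps))

  module _ {n r : ℕ} {ps : List ℕ} {Is : List Interval} (blocks : InducedBlocks n ps Is)
    {It : Interval} (It∈Is : It ∈ₗ Is) (It-nonempty : 0 < len It) (end-It : end It ≡ n)
    {t : ℕ} (t-last : suc t ≡ n) (t∈ps : t ∈ₗ ps) where

    open InducedBlocks blocks

    private
      t<n : t < n
      t<n = subst (t <_) t-last (n<1+n t)

      m≤t : lo It ≤ t
      m≤t = s≤s⁻¹ (subst (lo It <_) (trans end-It (sym t-last)) (m<m+n (lo It) It-nonempty))

      last-descent⇔ : (σ : ColPerm n r) → Descent σ t ⇔ 0 < proj₂ (symbolAt σ t)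
      last-descent⇔ σ = mk⇔ from-descent (λ 0<c → subst (_≺ symbolAt σ t) end≡ (inj₁ 0<c))
        where
        end≡ : (suc n , 0) ≡ symbolAt σ (suc t)
        end≡ = trans (sym (symbolAt-end σ)) (cong (symbolAt σ) (sym t-last))
        from-descent : Descent σ t → 0 < proj₂ (symbolAt σ t)
        from-descent d with subst (_≺ symbolAt σ t) (sym end≡) d
        ... | inj₁ 0<c         = 0<c
        ... | inj₂ (_ , n<v)  = contradiction (symbolAt-value≤ σ t<n) (<⇒≱ (<-trans (n<1+n n) n<v))

    descents⇒positiveColours : (σ : ColPerm n r) → T (allDescents ps σ) →
      ∀ {p} → lo It ≤ p → p < n → 0 < proj₂ (symbolAt σ p)
    descents⇒positiveColours σ descents {p} m≤p p<n =
      downFrom (t ∸ p) p (m∸n+n≡m (s≤s⁻¹ (subst (p <_) (sym t-last) p<n))) m≤p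
      where
      downFrom : ∀ d p → d + p ≡ t → lo It ≤ p → 0 < proj₂ (symbolAt σ p)
      downFrom zero    p refl _   = Equivalence.to (last-descent⇔ σ) (allDescents⁻ descents t∈ps)
      downFrom (suc d) p d+p≡t m≤p = <-≤-trans (downFrom d (suc p) (trans (+-suc d p) d+p≡t) (≤-trans m≤p (n≤1+n p)))
        (≺⇒colour≤ (allDescents⁻ descents (joined It∈Is m≤p (subst (suc p <_) (sym end-It) 1+p<n))))
        where
        1+p<n : suc p < n
        1+p<n = subst (suc p <_) t-last (s≤s (subst (suc p ≤_) d+p≡t (s≤s (m≤n+m p d))))

    descents⇒descendingBlocks : (σ : ColPerm n r) → T (allDescents ps σ) → T (descendingBlocks Is σ)
    descents⇒descendingBlocks σ descents = all⁻ _ (All.tabulate λ {I} I∈Is →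
      descendingBlock⁺ (lo I) (len I) σ (All.lookup bounded I∈Is) λ {i} 1+i<len →
        allDescents⁻ descents (joined I∈Is (m≤m+n (lo I) i) (subst (_< end I) (+-suc (lo I) i) (+-monoʳ-< (lo I) 1+i<len))))

    blocks⇒descents : (σ : ColPerm n r) → T (positiveColoursFrom (lo It) σ) → T (descendingBlocks Is σ) → T (allDescents ps σ)
    blocks⇒descents σ colours descBlocks = allDescents⁺ descent
      where
      descent : ∀ {p} → p ∈ₗ ps → Descent σ p
      descent {p} p∈ps with m≤n⇒m<n∨m≡n (All.lookup below p∈ps)
      ... | inj₂ 1+p≡n = subst (Descent σ) (suc-injective (trans t-last (sym 1+p≡n)))
        (Equivalence.from (last-descent⇔ σ) (positiveColoursFrom⁻ (lo It) σ colours m≤t t<n))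
      ... | inj₁ 1+p<n with cut p∈ps 1+p<n
      ...   | I , I∈Is , lo≤p , 1+p<end = subst (Descent σ) (m+[n∸m]≡n lo≤p)
        (descendingBlock⁻ (lo I) (len I) σ (All.lookup bounded I∈Is) (All.lookup (all⁺ _ Is descBlocks) I∈Is)
          (+-cancelˡ-< (lo I) _ _ (subst (_< end I) (trans (cong suc (sym (m+[n∸m]≡n lo≤p))) (sym (+-suc (lo I) _))) 1+p<end)))

    allDescents≡ : (σ : ColPerm n r) → allDescents ps σ ≡ positiveColoursFrom (lo It) σ ∧ descendingBlocks Is σ
    allDescents≡ σ = T-ext
      (λ descents → Equivalence.from T-∧
        ( positiveColoursFrom⁺ (lo It) σ (≤-trans m≤t (<⇒≤ t<n)) (descents⇒positiveColours σ descents)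
        , descents⇒descendingBlocks σ descents))
      (λ both → let (colours , descBlocks) = Equivalence.to T-∧ both in blocks⇒descents σ colours descBlocks)

    apart-from-top : ∀ {I} → I ∈ₗ Is → lo It ≤ lo I ⊎ end I ≤ lo It
    apart-from-top I∈Is with AllPairs-∈ apart It∈Is I∈Is
    ... | inj₁ refl              = inj₁ ≤-refl
    ... | inj₂ (inj₁ (inj₁ I≤It)) = inj₂ I≤It
    ... | inj₂ (inj₁ (inj₂ It≤I)) = inj₁ (≤-trans (m≤m+n (lo It) (len It)) It≤I)
    ... | inj₂ (inj₂ (inj₁ It≤I)) = inj₁ (≤-trans (m≤m+n (lo It) (len It)) It≤I)
    ... | inj₂ (inj₂ (inj₂ I≤It)) = inj₂ I≤It

    count-allDescents : count (allDescents {n} {r} ps) * factorials Is ≡ length (Perms n) * (r ^ lo It * (r ∸ 1) ^ len It)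
    count-allDescents = begin
      count {n} {r} (allDescents ps) * factorials Is
        ≡⟨ cong (_* factorials Is) (count-cong allDescents≡) ⟩
      count {n} {r} (λ σ → positiveColoursFrom (lo It) σ ∧ descendingBlocks Is σ) * factorials Is
        ≡⟨ count-descendingBlocks Is apart bounded
             (All.tabulate λ {I} I∈Is → positiveColoursFrom-invariant (lo It) I (apart-from-top I∈Is)) ⟩
      count {n} {r} (positiveColoursFrom (lo It))
        ≡⟨ count-positiveColoursFrom n r (lo It) (subst (lo It ≤_) end-It (m≤m+n (lo It) (len It))) ⟩
      length (Perms n) * (r ^ lo It * (r ∸ 1) ^ (n ∸ lo It))
        ≡⟨ cong (λ k → length (Perms n) * (r ^ lo It * (r ∸ 1) ^ (k ∸ lo It))) (sym end-It) ⟩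
      length (Perms n) * (r ^ lo It * (r ∸ 1) ^ (lo It + len It ∸ lo It))
        ≡⟨ cong (λ k → length (Perms n) * (r ^ lo It * (r ∸ 1) ^ k)) (m+n∸m≡n (lo It) (len It)) ⟩
      length (Perms n) * (r ^ lo It * (r ∸ 1) ^ len It) ∎
      where open ≡-Reasoning

  length≡∑1 : (xs : List A) → length xs ≡ ∑[ _ ∈ xs ] 1
  length≡∑1 xs = sym (trans (∑-const xs 1) (*-identityʳ (length xs)))

  length-allVecs : ∀ n m → length (allVecs n m) ≡ m ^ n
  length-allVecs zero    m = refl
  length-allVecs (suc n) m = begin
    length (allVecs (suc n) m)                       ≡⟨ length≡∑1 (allVecs (suc n) m) ⟩
    ∑[ _ ∈ allVecs (suc n) m ] 1                     ≡⟨ ∑-allVecs-suc n m (λ _ → 1) ⟩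
    ∑[ _ ∈ allVecs n m ] ∑[ _ ∈ allFin m ] 1         ≡⟨ ∑-const (allVecs n m) _ ⟩
    length (allVecs n m) * ∑[ _ ∈ allFin m ] 1       ≡⟨ cong₂ _*_ (length-allVecs n m) (sym (length≡∑1 (allFin m))) ⟩
    m ^ n * length (allFin m)                        ≡⟨ cong (m ^ n *_) (length-tabulate {n = m} id) ⟩
    m ^ n * m                                        ≡⟨ *-comm (m ^ n) m ⟩
    m * m ^ n                                        ∎
    where open ≡-Reasoning

  ∈-allVecs : ∀ {n m} (v : Vec (Fin m) n) → v ∈ₗ allVecs n m
  ∈-allVecs Vec.[]       = here refl
  ∈-allVecs (x Vec.∷ v) =
    ∈-concat⁺′ (∈-map⁺ (Vec._∷ v) (∈-allFin x)) (∈-map⁺ (λ w → map (Vec._∷ w) (allFin _)) (∈-allVecs v))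

  toList-tabulate : ∀ n (f : Fin n → A) → toList (Vec.tabulate f) ≡ List.tabulate f
  toList-tabulate zero    f = refl
  toList-tabulate (suc n) f = cong (f Fin.zero ∷_) (toList-tabulate n (λ i → f (Fin.suc i)))

  Perms-nonempty : ∀ n → NonZero (length (Perms n))
  Perms-nonempty n = nonempty (∈-filter⁺ (λ v → unique? _≟ᶠ_ (toList v)) (∈-allVecs identity) identity-unique)
    where
    identity : Vec (Fin n) n
    identity = Vec.allFin n
    identity-unique : Unique (toList identity)
    identity-unique = subst Unique (sym (toList-tabulate n id)) (Unique.allFin⁺ n)
    nonempty : ∀ {A : Set} {x : A} {xs} → x ∈ₗ xs → NonZero (length xs)
    nonempty {xs = _ ∷ _} _ = _

  length-S : ∀ n r → length (S n r) ≡ length (Perms n) * r ^ n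
  length-S n r = begin
    length (S n r)                                     ≡⟨ length≡∑1 (S n r) ⟩
    ∑[ _ ∈ S n r ] 1                                   ≡⟨ ∑-S n r (λ _ → 1) ⟩
    ∑[ _ ∈ Perms n ] ∑[ _ ∈ allVecs n r ] 1            ≡⟨ ∑-const (Perms n) _ ⟩
    length (Perms n) * ∑[ _ ∈ allVecs n r ] 1
      ≡⟨ cong (length (Perms n) *_) (trans (sym (length≡∑1 (allVecs n r))) (length-allVecs n r)) ⟩
    length (Perms n) * r ^ n                           ∎
    where open ≡-Reasoning

  factorials≢0 : ∀ Is → NonZero (factorials Is)
  factorials≢0 Is = product≢0 (All.map⁺ (All.universal (λ I → len I !≢0) Is))

  cross-multiplied : ∀ N D P r c m k → N * D ≡ P * (r ^ m * c ^ k) → N * (r ^ k * D) ≡ c ^ k * 1 * (P * r ^ (m + k))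
  cross-multiplied N D P r c m k counted = begin
    N * (r ^ k * D)                  ≡⟨ solve 3 (λ N rk D → N :* (rk :* D) := rk :* (N :* D)) refl N (r ^ k) D ⟩
    r ^ k * (N * D)                  ≡⟨ cong (r ^ k *_) counted ⟩
    r ^ k * (P * (r ^ m * c ^ k))
      ≡⟨ solve 4 (λ rk P rm ck → rk :* (P :* (rm :* ck)) := ck :* con 1 :* (P :* (rm :* rk))) refl (r ^ k) P (r ^ m) (c ^ k) ⟩
    c ^ k * 1 * (P * (r ^ m * r ^ k)) ≡⟨ cong (λ x → c ^ k * 1 * (P * x)) (^-distribˡ-+-* r m k) ⟨
    c ^ k * 1 * (P * r ^ (m + k))    ∎
    where
    open ≡-Reasoning
    open +-*-Solver

open import Data.Nat using (ℕ; _∸_; NonZero)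
open import Data.Fin using (Fin)
open import Data.Fin.Subset using (Subset; _∈_; ∣_∣)
open import Data.List using (List)
open import Data.List.Membership.Propositional using () renaming (_∈_ to _∈ₗ_)
open import Data.Integer using (+_)
open import Data.Rational using (ℚ; _/_; _*_)
open import Data.Product using (∃; _×_)
open import Relation.Binary.PropositionalEquality using (_≡_)

open import Data.Nat as ℕ using (zero; suc; _^_; _!; _≤_)
open import Data.Nat.Properties using (m*n≢0; m^n≢0; _!≢0)
open import Data.Fin using (toℕ)
import Data.Integer.Properties as ℤ
open import Data.List using ([]; _∷_; map; length)
open import Data.List.Membership.Propositional.Properties using (∈-map⁺)
open import Data.List.Relation.Unary.All as All using (All; []; _∷_)
open import Data.Product using (_,_; proj₁; proj₂)
open import Data.Rational.Properties using (toℚᵘ-injective; toℚᵘ-homo-*; toℚᵘ-fromℚᵘ; fromℚᵘ-cong; /-cong)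
import Data.Rational.Unnormalised as ℚᵘ
import Data.Rational.Unnormalised.Properties as ℚᵘ
open import Relation.Binary.PropositionalEquality using (refl; cong; cong₂; trans; sym; subst; module ≡-Reasoning)

avg≡ : {A : Set} (xs : List A) (f : A → ℕ) .{{_ : NonZero (length xs)}} → avg xs f ≡ (+ ∑ xs f) / length xs
avg≡ xs f with length xs
... | suc _ = refl

/-cross : ∀ a b c d .{{_ : NonZero b}} .{{_ : NonZero d}} → a ℕ.* d ≡ c ℕ.* b → (+ a) / b ≡ (+ c) / d
/-cross a (suc b) c (suc d) eq = fromℚᵘ-cong {ℚᵘ.mkℚᵘ (+ a) b} {ℚᵘ.mkℚᵘ (+ c) d}
  (ℚᵘ.*≡* (trans (sym (ℤ.pos-* a (suc d))) (trans (cong +_ eq) (ℤ.pos-* c (suc b)))))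

/-* : ∀ a b c d .{{_ : NonZero b}} .{{_ : NonZero d}} →
  ((+ a) / b) * ((+ c) / d) ≡ _/_ (+ (a ℕ.* c)) (b ℕ.* d) {{m*n≢0 b d}}
/-* a (suc b) c (suc d) = toℚᵘ-injective (ℚᵘ.≃-trans (toℚᵘ-homo-* ((+ a) / suc b) ((+ c) / suc d))
  (ℚᵘ.≃-trans (ℚᵘ.*-cong (toℚᵘ-fromℚᵘ (ℚᵘ.mkℚᵘ (+ a) b)) (toℚᵘ-fromℚᵘ (ℚᵘ.mkℚᵘ (+ c) d)))
    (ℚᵘ.≃-trans (ℚᵘ.≃-reflexive (cong (λ z → ℚᵘ.mkℚᵘ z (d ℕ.+ b ℕ.* suc d)) (sym (ℤ.pos-* a c))))
      (ℚᵘ.≃-sym (toℚᵘ-fromℚᵘ (ℚᵘ.mkℚᵘ (+ (a ℕ.* c)) (d ℕ.+ b ℕ.* suc d)))))))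

/-^ : ∀ a b k .{{_ : NonZero b}} → ((+ a) / b) ^ℚ k ≡ _/_ (+ (a ^ k)) (b ^ k) {{m^n≢0 b k}}
/-^ a b zero    = refl
/-^ a b (suc k) {{b≢0}} = trans (cong (((+ a) / b) *_) (/-^ a b k)) (/-* a b (a ^ k) (b ^ k) {{b≢0}} {{m^n≢0 b k {{b≢0}}}})

invFactProd-⟦⟧ : ∀ {n} Is → All (λ I → end I ≤ n) Is →
  invFactProd (map (⟦_⟧ {n}) Is) ≡ _/_ (+ 1) (factorials Is) {{factorials≢0 Is}}
invFactProd-⟦⟧ []       []             = refl
invFactProd-⟦⟧ {n} (I ∷ Is) (end≤n ∷ ends) = begin
  _/_ (+ 1) (∣ ⟦_⟧ {n} I ∣ !) {{∣ ⟦_⟧ {n} I ∣ !≢0}} * invFactProd (map (⟦_⟧ {n}) Is)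
    ≡⟨ cong₂ (λ k q → _/_ (+ 1) (k !) {{k !≢0}} * q) (∣⟦⟧∣ I end≤n) (invFactProd-⟦⟧ Is ends) ⟩
  _/_ (+ 1) (len I !) {{len I !≢0}} * _/_ (+ 1) (factorials Is) {{factorials≢0 Is}}
    ≡⟨ /-* 1 (len I !) 1 (factorials Is) {{len I !≢0}} {{factorials≢0 Is}} ⟩
  _/_ (+ 1) (len I ! ℕ.* factorials Is) {{factorials≢0 (I ∷ Is)}} ∎
  where open ≡-Reasoning

E-from-count : ∀ n r .{{_ : NonZero r}} (F : ColPerm n r → ℕ) D .{{_ : NonZero D}} m k → m ℕ.+ k ≡ n →
  ∑ (S n r) F ℕ.* D ≡ length (Perms n) ℕ.* (r ^ m ℕ.* (r ∸ 1) ^ k) →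
  E n r F ≡ ((+ (r ∸ 1)) / r) ^ℚ k * ((+ 1) / D)
E-from-count n r {{r≢0}} F D {{D≢0}} m k refl counted = begin
  E n r F                                                 ≡⟨ avg≡ (S n r) F {{|S|≢0}} ⟩
  _/_ (+ ∑ (S n r) F) (length (S n r)) {{|S|≢0}}
    ≡⟨ /-cong {+ ∑ (S n r) F} {length (S n r)} {+ ∑ (S n r) F} {P ℕ.* r ^ n} {{|S|≢0}} {{P*rⁿ≢0}} refl (length-S n r) ⟩
  _/_ (+ ∑ (S n r) F) (P ℕ.* r ^ n) {{P*rⁿ≢0}}
    ≡⟨ /-cross (∑ (S n r) F) (P ℕ.* r ^ n) (c ^ k ℕ.* 1) (r ^ k ℕ.* D) {{P*rⁿ≢0}} {{m*n≢0 (r ^ k) D {{m^n≢0 r k}}}}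
         (cross-multiplied (∑ (S n r) F) D P r c m k counted) ⟩
  _/_ (+ (c ^ k ℕ.* 1)) (r ^ k ℕ.* D) {{m*n≢0 (r ^ k) D {{m^n≢0 r k}}}}
    ≡⟨ /-* (c ^ k) (r ^ k) 1 D {{m^n≢0 r k}} ⟨
  _/_ (+ c ^ k) (r ^ k) {{m^n≢0 r k}} * ((+ 1) / D)     ≡⟨ cong (_* ((+ 1) / D)) (/-^ c r k) ⟨
  ((+ c) / r) ^ℚ k * ((+ 1) / D)                        ∎
  where
  open ≡-Reasoning
  P c : ℕ
  P = length (Perms n)
  c = r ∸ 1
  P*rⁿ≢0 : NonZero (P ℕ.* r ^ n)
  P*rⁿ≢0 = m*n≢0 P (r ^ n) {{Perms-nonempty n}} {{m^n≢0 r n}}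
  |S|≢0 : NonZero (length (S n r))
  |S|≢0 = subst NonZero (sym (length-S n r)) P*rⁿ≢0

corollary3p8 : (n r : ℕ) .{{_ : NonZero r}} (as : List (Fin n)) (Bs : List (Subset n)) (Bt : Subset n) →
    IsBlockList as Bs → Bt ∈ₗ Bs → (∃ λ i → IsTop i × i ∈ Bt) →
    (∃ λ a → IsTop a × a ∈ₗ as) →
    E n r (prodX as) ≡ (((+ (r ∸ 1)) / r) ^ℚ ∣ Bt ∣) * invFactProd Bs
corollary3p8 n r as Bs Bt blockList Bt∈Bs (t , t-top , t∈Bt) (a , a-top , a∈as)
  with blockList⇒intervals as blockList
... | Is , refl , Is-blocks , blocks with top-interval as Is-blocks Bt∈Bs t-top t∈Bt
...   | It , It∈Is , refl , end-It = begin
  E n r (prodX as)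
    ≡⟨ E-from-count n r (prodX as) (factorials Is) {{factorials≢0 Is}} (lo It) (len It) end-It counted ⟩
  ((+ (r ∸ 1)) / r) ^ℚ len It * _/_ (+ 1) (factorials Is) {{factorials≢0 Is}}
    ≡⟨ cong₂ (λ k q → ((+ (r ∸ 1)) / r) ^ℚ k * q)
             (∣⟦⟧∣ It It-bounded) (invFactProd-⟦⟧ Is (InducedBlocks.bounded blocks)) ⟨
  ((+ (r ∸ 1)) / r) ^ℚ ∣ ⟦_⟧ {n} It ∣ * invFactProd (map (⟦_⟧ {n}) Is) ∎
  where
  open ≡-Reasoning
  It-bounded : end It ≤ n
  It-bounded = proj₂ (proj₂ (All.lookup Is-blocks It∈Is))
  counted : ∑ (S n r) (prodX as) ℕ.* factorials Is ≡ length (Perms n) ℕ.* (r ^ lo It ℕ.* (r ∸ 1) ^ len It)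
  counted = trans (cong (ℕ._* factorials Is) (∑-cong (S n r) (prodX≡𝟙-allDescents as)))
    (count-allDescents blocks It∈Is (proj₁ (proj₂ (All.lookup Is-blocks It∈Is))) end-It a-top (∈-map⁺ toℕ a∈as))
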